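{- For every integer $k\geq 2$ there is a $2$-connected outerplanar graph $G$ with maximum degree $3$ such that every covering of $G$ by connected subgraphs of maximum degree at most $2$ consists of at least $k$ subgraphs.
   Context: A covering of a graph $G$ is a set of connected subgraphs of $G$ such that every edge of $G$ lies in at least one of them. -}

module Defs where

open import Data.Nat using (ℕ; _≤_; _<_)
open import Data.Bool using (Bool; true; false)
open import Data.Fin using (Fin)
open import Data.List using (length; filterᵇ; allFin)
open import Data.Product using (Σ; _×_; ∃-syntax)
open import Relation.Nullary using (¬_)
open import Relation.Binary.PropositionalEquality using (_≡_; _≢_)
open import Relation.Binary.Construct.Closure.ReflexiveTransitive using (Star)
open import Function.Definitions using (Injective)

record Graph : Set where
  field
    n      : ℕ
    adj    : Fin n → Fin n → Bool
    adj-sym    : ∀ u v → adj u v ≡ adj v u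
    adj-irrefl : ∀ v → adj v v ≡ false
open Graph public

Edge : (G : Graph) → Fin (n G) → Fin (n G) → Set
Edge G u v = adj G u v ≡ true

degreeIn : {m : ℕ} → (Fin m → Fin m → Bool) → Fin m → ℕ
degreeIn {m} e v = length (filterᵇ (e v) (allFin m))

degree : (G : Graph) → Fin (n G) → ℕ
degree G = degreeIn (adj G)

MaxDegree : Graph → ℕ → Set
MaxDegree G d = (∀ v → degree G v ≤ d) × (∃[ v ] degree G v ≡ d)

Connected : Graph → Set
Connected G = ∀ u v → Star (Edge G) u v

TwoConnected : Graph → Set
TwoConnected G =
  (3 ≤ n G) × Connected G ×
  (∀ x u v → u ≢ x → v ≢ x →
     Star (λ a b → Edge G a b × a ≢ x × b ≢ x) u v)

-- Outerplanar: vertices can be placed in (cyclic) order on a circle, given by an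
-- injective position map, so that no two edges (drawn as chords) cross.
Outerplanar : Graph → Set
Outerplanar G = Σ (Fin (n G) → ℕ) λ pos →
  Injective _≡_ _≡_ pos ×
  (∀ a b c d → Edge G a b → Edge G c d →
     ¬ (pos a < pos c × pos c < pos b × pos b < pos d))

record Subgraph (G : Graph) : Set where
  field
    vert : Fin (n G) → Bool
    edge : Fin (n G) → Fin (n G) → Bool
    edge-sym  : ∀ u v → edge u v ≡ edge v u
    edge-adj  : ∀ u v → edge u v ≡ true → Edge G u v
    edge-vert : ∀ u v → edge u v ≡ true → vert u ≡ true
open Subgraph public

ConnectedSub : {G : Graph} → Subgraph G → Set
ConnectedSub H =
  (∃[ v ] vert H v ≡ true) ×
  (∀ u v → vert H u ≡ true → vert H v ≡ true →
     Star (λ a b → edge H a b ≡ true) u v)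

MaxDegreeSubAtMost : {G : Graph} → Subgraph G → ℕ → Set
MaxDegreeSubAtMost H d = ∀ v → degreeIn (edge H) v ≤ d

Covers : (G : Graph) {m : ℕ} → (Fin m → Subgraph G) → Set
Covers G {m} F = ∀ u v → Edge G u v → ∃[ i ] edge (F i) u v ≡ true

-- Nest intervals of a path like the nodes of a complete binary tree of depth d and join the two
-- ends of every interval by a chord.  The resulting graph is outerplanar, the root chord closes a
-- Hamiltonian cycle, and every vertex lies on at most one chord.  Give a chord at height i the
-- weight 2 ^ i.  Each of the d levels below the root weighs 2 ^ d, so a covering has total weight
-- at least d · 2 ^ d.  A connected subgraph H of maximum degree 2 is a path or a cycle and has at
-- most two ends.  By induction over the tree, the part of H inside an interval of height j that
-- contains K ≤ 2 ends of H weighs at most (K + 1) · 2 ^ j, so H weighs at most 3 · 2 ^ d and a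
-- covering has at least d / 3 members.  The inductive step is a finite analysis of how H meets
-- the two children of an interval, checked by exhaustive evaluation.

module Submission where

open import Data.Bool using (Bool; true; false; _∧_; _∨_; not; if_then_else_)
open import Data.Bool.Properties using (¬-not; ∧-identityʳ; ∧-zeroʳ; ∨-comm)
open import Data.Empty using (⊥; ⊥-elim)
open import Data.Fin using (Fin; toℕ; fromℕ<)
import Data.Fin.Properties as Finₚ
open import Data.List using (List; []; _∷_; _++_; length; map; filterᵇ; tabulate)
open import Data.List.Membership.Propositional using (_∈_)
open import Data.List.Membership.Propositional.Properties using (∈-map⁺)
open import Data.List.Properties using (length-++; map-∘)
open import Data.List.Relation.Unary.All as All using (All; []; _∷_)
open import Data.List.Relation.Unary.All.Properties using (++⁺)
open import Data.List.Relation.Unary.AllPairs using (AllPairs; []; _∷_)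
open import Data.List.Relation.Unary.Any using (here; there)
open import Data.List.Relation.Unary.Unique.Propositional using (Unique)
open import Data.Nat
  using (ℕ; zero; suc; pred; _+_; _*_; _^_; _∸_; _≤_; _<_; z≤n; s≤s; _≟_; _<?_; _≤?_; >-nonZero)
open import Data.Nat.Divisibility using (_∣_; _∣?_; ∣m∣n⇒∣m+n; ∣m+n∣m⇒∣n; m∣m*n)
open import Data.Nat.ListAction using (sum)
open import Data.Nat.Properties
open import Data.Nat.Tactic.RingSolver using (solve-∀)
open import Data.Product using (Σ; _×_; _,_; proj₁; proj₂; ∃-syntax)
open import Data.Sum using (_⊎_; inj₁; inj₂; [_,_]′)
open import Data.Unit using (⊤; tt)
open import Data.Vec using (Vec; []; _∷_)
open import Function using (_∘_; id; flip)
open import Relation.Binary.Construct.Closure.ReflexiveTransitive as Star using (Star; ε; _◅_; _◅◅_)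
open import Relation.Binary.Definitions using (tri<; tri≈; tri>)
open import Relation.Binary.PropositionalEquality
open import Relation.Nullary using (¬_; Dec; yes; no; does; contradiction)
open import Relation.Nullary.Decidable using (dec-true; dec-false; _×-dec_)

open import Defs

-- Counting over Fin n

∧≡true⇒ : ∀ {a b} → a ∧ b ≡ true → a ≡ true × b ≡ true
∧≡true⇒ {true} b≡true = refl , b≡true

∨≡true⇒ : ∀ {a b} → a ∨ b ≡ true → a ≡ true ⊎ b ≡ true
∨≡true⇒ {true}  _       = inj₁ refl
∨≡true⇒ {false} b≡true = inj₂ b≡true

∨≡false⇒ : ∀ {a b} → a ∨ b ≡ false → a ≡ false × b ≡ false
∨≡false⇒ {false} b≡false = refl , b≡false

∨-cases : ∀ {X : Set} {a b} → a ∨ b ≡ true → (a ≡ true → X) → (b ≡ true → X) → X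
∨-cases {a = true}  _      f g = f refl
∨-cases {a = false} b≡true f g = g b≡true

∨≡trueˡ : ∀ {a} b → a ≡ true → a ∨ b ≡ true
∨≡trueˡ b refl = refl

∨≡trueʳ : ∀ a {b} → b ≡ true → a ∨ b ≡ true
∨≡trueʳ true  _       = refl
∨≡trueʳ false b≡true = b≡true

does≡true⇒ : ∀ {A : Set} (a? : Dec A) → does a? ≡ true → A
does≡true⇒ (yes a) _ = a

bit : Bool → ℕ
bit false = 0
bit true  = 1

bit-∨ : ∀ a b → bit (a ∨ b) ≤ bit a + bit b
bit-∨ false b = ≤-refl
bit-∨ true  b = s≤s z≤n

∑ : ∀ {m} → (Fin m → ℕ) → ℕ
∑ {zero}  f = 0
∑ {suc m} f = f Fin.zero + ∑ (f ∘ Fin.suc)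

∑-cong : ∀ {m} {f g : Fin m → ℕ} → (∀ x → f x ≡ g x) → ∑ f ≡ ∑ g
∑-cong {zero}  f≗g = refl
∑-cong {suc m} f≗g = cong₂ _+_ (f≗g Fin.zero) (∑-cong (f≗g ∘ Fin.suc))

∑-mono : ∀ {m} {f g : Fin m → ℕ} → (∀ x → f x ≤ g x) → ∑ f ≤ ∑ g
∑-mono {zero}  f≤g = z≤n
∑-mono {suc m} f≤g = +-mono-≤ (f≤g Fin.zero) (∑-mono (f≤g ∘ Fin.suc))

∑-mono-< : ∀ {m} {f g : Fin m → ℕ} → (∀ x → f x ≤ g x) → ∀ z → f z < g z → ∑ f < ∑ g
∑-mono-< {suc m} f≤g Fin.zero    fz<gz = +-mono-<-≤ fz<gz (∑-mono (f≤g ∘ Fin.suc))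
∑-mono-< {suc m} f≤g (Fin.suc z) fz<gz = +-mono-≤-< (f≤g Fin.zero) (∑-mono-< (f≤g ∘ Fin.suc) z fz<gz)

≤-∑ : ∀ {m} (f : Fin m → ℕ) z → f z ≤ ∑ f
≤-∑ {suc m} f Fin.zero    = m≤m+n _ _
≤-∑ {suc m} f (Fin.suc z) = ≤-trans (≤-∑ (f ∘ Fin.suc) z) (m≤n+m _ _)

∑-+ : ∀ {m} (f g : Fin m → ℕ) → ∑ (λ x → f x + g x) ≡ ∑ f + ∑ g
∑-+ {zero}  f g = refl
∑-+ {suc m} f g = trans (cong (f Fin.zero + g Fin.zero +_) (∑-+ (f ∘ Fin.suc) (g ∘ Fin.suc)))
                        (exchange (f Fin.zero) (g Fin.zero) _ _)
  where
  exchange : ∀ a b c d → a + b + (c + d) ≡ a + c + (b + d)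
  exchange = solve-∀

∑-*ˡ : ∀ {m} c (f : Fin m → ℕ) → ∑ (λ x → c * f x) ≡ c * ∑ f
∑-*ˡ {zero}  c f = sym (*-zeroʳ c)
∑-*ˡ {suc m} c f = trans (cong (c * f Fin.zero +_) (∑-*ˡ c (f ∘ Fin.suc)))
                         (sym (*-distribˡ-+ c (f Fin.zero) _))

∑-const : ∀ {m} c → ∑ {m} (λ _ → c) ≡ m * c
∑-const {zero}  c = refl
∑-const {suc m} c = cong (c +_) (∑-const {m} c)

count : ∀ {n} → (Fin n → Bool) → ℕ
count p = ∑ (bit ∘ p)

length-filterᵇ-tabulate : ∀ {A : Set} {n} (p : A → Bool) (f : Fin n → A) →
  length (filterᵇ p (tabulate f)) ≡ count (p ∘ f)
length-filterᵇ-tabulate {n = zero}  p f = refl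
length-filterᵇ-tabulate {n = suc n} p f with p (f Fin.zero)
... | true  = cong suc (length-filterᵇ-tabulate p (f ∘ Fin.suc))
... | false = length-filterᵇ-tabulate p (f ∘ Fin.suc)

degreeIn≡count : ∀ {n} (e : Fin n → Fin n → Bool) v → degreeIn e v ≡ count (e v)
degreeIn≡count e v = length-filterᵇ-tabulate (e v) id

module _ {n : ℕ} where

  _─_ : (Fin n → Bool) → Fin n → (Fin n → Bool)
  (p ─ w) x = p x ∧ not (does (x Finₚ.≟ w))

  ─-≢ : ∀ p {w x} → x ≢ w → (p ─ w) x ≡ p x
  ─-≢ p {w} {x} x≢w rewrite dec-false (x Finₚ.≟ w) x≢w = ∧-identityʳ (p x)

  ─-self : ∀ p w → (p ─ w) w ≡ false
  ─-self p w rewrite dec-true (w Finₚ.≟ w) refl = ∧-zeroʳ (p w)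

  count-cong : {p q : Fin n → Bool} → (∀ x → p x ≡ q x) → count p ≡ count q
  count-cong p≗q = ∑-cong (cong bit ∘ p≗q)

  count-mono : {p q : Fin n → Bool} → (∀ x → p x ≡ true → q x ≡ true) → count p ≤ count q
  count-mono p⇒q = ∑-mono λ x → bit-mono (p⇒q x)
    where
    bit-mono : ∀ {a b} → (a ≡ true → b ≡ true) → bit a ≤ bit b
    bit-mono {false} _   = z≤n
    bit-mono {true}  a⇒b rewrite a⇒b refl = ≤-refl

  count-∨ : (p q : Fin n → Bool) → count (λ x → p x ∨ q x) ≤ count p + count q
  count-∨ p q = ≤-trans (∑-mono λ x → bit-∨ (p x) (q x)) (≤-reflexive (∑-+ (bit ∘ p) (bit ∘ q)))

  count-zero : {p : Fin n → Bool} → (∀ x → p x ≡ false) → count p ≡ 0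
  count-zero {p} p≗false = trans (count-cong p≗false) (trans (∑-const {n} 0) (*-zeroʳ n))

  ─-true : ∀ p {w x} → (p ─ w) x ≡ true → p x ≡ true × x ≢ w
  ─-true p {w} {x} h with p x | x Finₚ.≟ w
  ... | true | no x≢w = refl , x≢w

  1≤count : (p : Fin n → Bool) → ∀ {x} → p x ≡ true → 1 ≤ count p
  1≤count p {x} px = subst (λ b → bit b ≤ count p) px (≤-∑ (bit ∘ p) x)

count-witness : ∀ {n} (p : Fin n → Bool) → 1 ≤ count p → ∃[ x ] p x ≡ true
count-witness {suc n} p 1≤count with p Fin.zero in p0
... | true  = Fin.zero , p0
... | false with x , px ← count-witness (p ∘ Fin.suc) 1≤count = Fin.suc x , px

count-remove : ∀ {n} (p : Fin n → Bool) w → count p ≡ bit (p w) + count (p ─ w)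
count-remove {suc n} p Fin.zero =
  cong (bit (p Fin.zero) +_)
    (trans (count-cong λ x → sym (─-≢ p {Fin.zero} {Fin.suc x} λ ()))
           (cong (λ b → bit b + count ((p ─ Fin.zero) ∘ Fin.suc)) (sym (─-self p Fin.zero))))
count-remove {suc n} p (Fin.suc w) = begin
  bit (p Fin.zero) + count (p ∘ Fin.suc)
    ≡⟨ cong (bit (p Fin.zero) +_) (count-remove (p ∘ Fin.suc) w) ⟩
  bit (p Fin.zero) + (bit (p (Fin.suc w)) + count ((p ∘ Fin.suc) ─ w))
    ≡⟨ swap (bit (p Fin.zero)) (bit (p (Fin.suc w))) _ ⟩
  bit (p (Fin.suc w)) + (bit (p Fin.zero) + count ((p ∘ Fin.suc) ─ w))
    ≡⟨ cong (λ b → bit (p (Fin.suc w)) + (bit b + count ((p ∘ Fin.suc) ─ w)))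
            (sym (─-≢ p {Fin.suc w} {Fin.zero} λ ())) ⟩
  bit (p (Fin.suc w)) + count (p ─ Fin.suc w) ∎
  where
  open ≡-Reasoning
  swap : ∀ a b c → a + (b + c) ≡ b + (a + c)
  swap = solve-∀

count-support : ∀ {n} (p : Fin n → Bool) {ws} → Unique ws → (∀ x → p x ≡ true → x ∈ ws) →
  count p ≡ sum (map (bit ∘ p) ws)
count-support p [] p⊆[] = count-zero λ x → outside (p x) (p⊆[] x)
  where
  outside : ∀ {A : Set} {x : A} b → (b ≡ true → x ∈ []) → b ≡ false
  outside false _    = refl
  outside true  x∈[] with () ← x∈[] refl
count-support p {w ∷ ws} (w∉ws ∷ unique) p⊆ = begin
  count p                                   ≡⟨ count-remove p w ⟩
  bit (p w) + count (p ─ w)                 ≡⟨ cong (bit (p w) +_) (count-support (p ─ w) unique p─w⊆) ⟩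
  bit (p w) + sum (map (bit ∘ (p ─ w)) ws)  ≡⟨ cong (bit (p w) +_) (sum-map-cong (All.map ─w≗ w∉ws)) ⟩
  bit (p w) + sum (map (bit ∘ p) ws)        ∎
  where
  open ≡-Reasoning
  p─w⊆ : ∀ x → (p ─ w) x ≡ true → x ∈ ws
  p─w⊆ x p─wx with ─-true p p─wx
  ... | px , x≢w with p⊆ x px
  ...   | here x≡w = contradiction x≡w x≢w
  ...   | there x∈ws = x∈ws
  ─w≗ : ∀ {x} → w ≢ x → bit ((p ─ w) x) ≡ bit (p x)
  ─w≗ w≢x = cong bit (─-≢ p (w≢x ∘ sym))
  sum-map-cong : ∀ {A : Set} {f g : A → ℕ} {xs} → All (λ x → f x ≡ g x) xs →
    sum (map f xs) ≡ sum (map g xs)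
  sum-map-cong []       = refl
  sum-map-cong (e ∷ es) = cong₂ _+_ e (sum-map-cong es)

count≤1 : ∀ {n} (p : Fin n → Bool) → (∀ x y → p x ≡ true → p y ≡ true → x ≡ y) → count p ≤ 1
count≤1 {zero}  p unique = z≤n
count≤1 {suc n} p unique with p Fin.zero in p0
... | true  = ≤-reflexive (cong suc (count-zero {p = p ∘ Fin.suc} λ x →
                ¬-not λ psx → Finₚ.0≢1+n (unique Fin.zero (Fin.suc x) p0 psx)))
... | false = count≤1 (p ∘ Fin.suc) λ x y px py → Finₚ.suc-injective (unique (Fin.suc x) (Fin.suc y) px py)

2≤count : ∀ {n} (p : Fin n → Bool) {x y} → x ≢ y → p x ≡ true → p y ≡ true → 2 ≤ count p
2≤count p {x} {y} x≢y px py rewrite count-remove p x | px =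
  s≤s (1≤count (p ─ x) (trans (─-≢ p (x≢y ∘ sym)) py))

-- Connected graphs of maximum degree 2

Star-invariant : ∀ {A : Set} {R : A → A → Set} (P : A → Set) →
  (∀ {x y} → R x y → P x → P y) → ∀ {x y} → Star R x y → P x → P y
Star-invariant P step = Star.fold (λ x y → P x → P y) (λ r f → f ∘ step r) id

module _ {n : ℕ} where

  BoolRel : Set
  BoolRel = Fin n → Fin n → Bool

  _∼[_]_ : Fin n → BoolRel → Fin n → Set
  a ∼[ e ] b = e a b ≡ true

  deg : BoolRel → Fin n → ℕ
  deg e x = count (e x)

  Linked : BoolRel → Set
  Linked e = ∀ u v → 1 ≤ deg e u → 1 ≤ deg e v → Star (_∼[ e ]_) u v

  _∖_ : BoolRel → Fin n → BoolRel
  (e ∖ u) a b = (e a ─ u) b ∧ not (does (a Finₚ.≟ u))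

module _ {n : ℕ} (e : BoolRel {n}) where

  neighbour-unique : ∀ {x y y'} → deg e x ≤ 1 → x ∼[ e ] y → x ∼[ e ] y' → y' ≡ y
  neighbour-unique {x} {y} {y'} deg≤1 xy xy' with y' Finₚ.≟ y
  ... | yes y'≡y = y'≡y
  ... | no  y'≢y = contradiction (≤-trans (2≤count (e x) y'≢y xy' xy) deg≤1) λ { (s≤s ()) }

  closed-edge : ∀ {a b c} → (∀ y → a ∼[ e ] y → y ≡ b) → (∀ y → b ∼[ e ] y → y ≡ a) →
    Star (_∼[ e ]_) a c → c ≢ a → c ≢ b → ⊥
  closed-edge {a} {b} only-b only-a path c≢a c≢b = [ c≢a , c≢b ]′ (Star-invariant P step path (inj₁ refl))
    where
    P : Fin n → Set
    P x = x ≡ a ⊎ x ≡ b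
    step : ∀ {x y} → x ∼[ e ] y → P x → P y
    step xy (inj₁ refl) = inj₂ (only-b _ xy)
    step xy (inj₂ refl) = inj₁ (only-a _ xy)

  ∖-sym : (∀ a b → e a b ≡ e b a) → ∀ u a b → (e ∖ u) a b ≡ (e ∖ u) b a
  ∖-sym sym-e u a b rewrite sym-e a b with e b a | does (a Finₚ.≟ u) | does (b Finₚ.≟ u)
  ... | false | _     | _     = refl
  ... | true  | false | false = refl
  ... | true  | false | true  = refl
  ... | true  | true  | false = refl
  ... | true  | true  | true  = refl

  ∖-⊆ : ∀ u {a b} → a ∼[ e ∖ u ] b → a ∼[ e ] b
  ∖-⊆ u {a} {b} h with e a b
  ... | true = refl

  deg-∖-self : ∀ u → deg (e ∖ u) u ≡ 0
  deg-∖-self u = count-zero λ y → trans (cong (λ b → (e u ─ u) y ∧ not b) (dec-true (u Finₚ.≟ u) refl))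
                                           (∧-zeroʳ _)

  deg-∖-≤ : ∀ u v → deg (e ∖ u) v ≤ deg e v
  deg-∖-≤ u v = count-mono λ y → ∖-⊆ u {v} {y}

  deg-∖ : ∀ u {x} → x ≢ u → bit (e x u) + deg (e ∖ u) x ≡ deg e x
  deg-∖ u {x} x≢u = sym (trans (count-remove (e x) u) (cong (bit (e x u) +_) (count-cong λ y → keep y)))
    where
    keep : ∀ y → (e x ─ u) y ≡ (e ∖ u) x y
    keep y rewrite dec-false (x Finₚ.≟ u) x≢u = sym (∧-identityʳ _)

  -- A path through an end u enters and leaves it via its unique neighbour, so it can be shortcut.
  path-∖-end : (∀ a b → e a b ≡ e b a) → ∀ {u w} → (∀ y → u ∼[ e ] y → y ≡ w) →
    ∀ {x v} → Star (_∼[ e ]_) x v → x ≢ u → v ≢ u → Star (_∼[ e ∖ u ]_) x v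
  path-∖-end sym-e only-w ε x≢u v≢u = ε
  path-∖-end sym-e {u} {w} only-w {x} {v} (_◅_ {j = y} xy path) x≢u v≢u with y Finₚ.≟ u
  ... | no  y≢u = xy' ◅ path-∖-end sym-e only-w path y≢u v≢u
    where
    xy' : x ∼[ e ∖ u ] y
    xy' rewrite ─-≢ (e x) y≢u | dec-false (x Finₚ.≟ u) x≢u = trans (∧-identityʳ _) xy
  ... | yes refl with path
  ...   | ε = contradiction refl v≢u
  ...   | _◅_ {j = z} uz path' = subst (λ t → Star (_∼[ e ∖ u ]_) t v) z≡x
          (path-∖-end sym-e only-w path' (x≢u ∘ trans (sym z≡x)) v≢u)
    where
    z≡x : z ≡ x
    z≡x = trans (only-w z uz) (sym (only-w x (trans (sym-e u x) xy)))

record PathOrCycle {n : ℕ} (e : BoolRel {n}) : Set where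
  field
    symmetric   : ∀ a b → e a b ≡ e b a
    irreflexive : ∀ a → e a a ≡ false
    deg≤2       : ∀ v → deg e v ≤ 2
    linked      : Linked e

module _ {n : ℕ} {e : BoolRel {n}} (G : PathOrCycle e) where
  open PathOrCycle G

  end-neighbour : ∀ {u} → deg e u ≡ 1 → Σ (Fin n) λ w → u ∼[ e ] w × (∀ y → u ∼[ e ] y → y ≡ w)
  end-neighbour {u} du with w , uw ← count-witness (e u) (≤-reflexive (sym du)) =
    w , uw , λ y uy → neighbour-unique e (≤-reflexive du) uw uy

  adjacent-ends : ∀ {u w c} → deg e u ≡ 1 → deg e w ≡ 1 → u ∼[ e ] w → u ≢ c → w ≢ c → deg e c ≡ 1 → ⊥
  adjacent-ends {u} {w} {c} du dw uw u≢c w≢c dc =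
    closed-edge e (λ y uy → neighbour-unique e (≤-reflexive du) uw uy)
                  (λ y wy → neighbour-unique e (≤-reflexive dw) (trans (symmetric w u) uw) wy)
      (linked u c (≤-reflexive (sym du)) (≤-reflexive (sym dc))) (u≢c ∘ sym) (w≢c ∘ sym)

  ∖-end : ∀ {u w} → (∀ y → u ∼[ e ] y → y ≡ w) → PathOrCycle (e ∖ u)
  ∖-end {u} only-w = record
    { symmetric   = ∖-sym e symmetric u
    ; irreflexive = irreflexive-∖
    ; deg≤2       = λ v → ≤-trans (deg-∖-≤ e u v) (deg≤2 v)
    ; linked      = λ x v 1≤x 1≤v → path-∖-end e symmetric only-w
                      (linked x v (≤-trans 1≤x (deg-∖-≤ e u x)) (≤-trans 1≤v (deg-∖-≤ e u v)))
                      (away 1≤x) (away 1≤v)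
    }
    where
    irreflexive-∖ : ∀ a → (e ∖ u) a a ≡ false
    irreflexive-∖ a with (e ∖ u) a a in loop
    ... | false = refl
    ... | true  with () ← trans (sym (∖-⊆ e u loop)) (irreflexive a)
    away : ∀ {x} → 1 ≤ deg (e ∖ u) x → x ≢ u
    away 1≤deg refl = contradiction (deg-∖-self e u) (λ eq → <⇒≢ 1≤deg (sym eq))

  ∑deg-∖-end : ∀ {u} → deg e u ≡ 1 → ∑ (deg (e ∖ u)) < ∑ (deg e)
  ∑deg-∖-end {u} du =
    ∑-mono-< (deg-∖-≤ e u) u (subst (_< deg e u) (sym (deg-∖-self e u)) (≤-reflexive (sym du)))

  deg-∖-neighbour : ∀ {u w} → u ∼[ e ] w → suc (deg (e ∖ u) w) ≡ deg e w
  deg-∖-neighbour {u} {w} uw =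
    trans (cong (λ b → bit b + deg (e ∖ u) w) (sym (trans (symmetric w u) uw))) (deg-∖ e u w≢u)
    where
    w≢u : w ≢ u
    w≢u refl = contradiction (trans (sym uw) (irreflexive u)) λ ()

  deg-∖-far : ∀ {u w x} → (∀ y → u ∼[ e ] y → y ≡ w) → x ≢ w → x ≢ u → deg (e ∖ u) x ≡ deg e x
  deg-∖-far {u} {w} {x} only-w x≢w x≢u =
    trans (cong (λ b → bit b + deg (e ∖ u) x) (sym x≁u)) (deg-∖ e u x≢u)
    where
    x≁u : e x u ≡ false
    x≁u = ¬-not λ xu → x≢w (only-w x (trans (symmetric u x) xu))

no-three-ends : ∀ {n} {e : BoolRel {n}} → PathOrCycle e → ∀ {u₁ u₂ u₃} → u₁ ≢ u₂ → u₁ ≢ u₃ → u₂ ≢ u₃ →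
  deg e u₁ ≡ 1 → deg e u₂ ≡ 1 → deg e u₃ ≡ 1 → ⊥
no-three-ends G = go _ G ≤-refl
  where
  -- Induction on the total degree: delete the end u₁, whose neighbour w then becomes an end.
  go : ∀ {n} k {e : BoolRel {n}} → PathOrCycle e → ∑ (deg e) ≤ k → ∀ {u₁ u₂ u₃} →
    u₁ ≢ u₂ → u₁ ≢ u₃ → u₂ ≢ u₃ → deg e u₁ ≡ 1 → deg e u₂ ≡ 1 → deg e u₃ ≡ 1 → ⊥
  go zero {e} G ∑≤0 {u₁} _ _ _ d₁ _ _ =
    contradiction (≤-trans (≤-reflexive (sym d₁)) (≤-trans (≤-∑ (deg e) u₁) ∑≤0)) λ ()
  go (suc k) {e} G ∑≤k {u₁} {u₂} {u₃} u₁≢u₂ u₁≢u₃ u₂≢u₃ d₁ d₂ d₃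
    with w , u₁w , only-w ← end-neighbour G d₁
    with w Finₚ.≟ u₂ | w Finₚ.≟ u₃ | deg e w in dw
  ... | yes refl | _        | _ = adjacent-ends G d₁ d₂ u₁w u₁≢u₃ u₂≢u₃ d₃
  ... | no _     | yes refl | _ = adjacent-ends G d₁ d₃ u₁w u₁≢u₂ (u₂≢u₃ ∘ sym) d₂
  ... | no _     | no _     | zero =
    contradiction (≤-trans (1≤count (e w) (trans (PathOrCycle.symmetric G w u₁) u₁w)) (≤-reflexive dw)) λ ()
  ... | no w≢u₂  | no _     | suc zero = adjacent-ends G d₁ dw u₁w u₁≢u₂ w≢u₂ d₂
  ... | no w≢u₂  | no w≢u₃  | suc (suc zero) =
    go k (∖-end G only-w) (≤-pred (≤-trans (∑deg-∖-end G d₁) ∑≤k)) w≢u₂ w≢u₃ u₂≢u₃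
      (suc-injective (trans (deg-∖-neighbour G u₁w) dw))
      (trans (deg-∖-far G only-w (w≢u₂ ∘ sym) (u₁≢u₂ ∘ sym)) d₂)
      (trans (deg-∖-far G only-w (w≢u₃ ∘ sym) (u₁≢u₃ ∘ sym)) d₃)
  ... | _        | _        | suc (suc (suc _)) =
    contradiction (≤-trans (≤-reflexive (sym dw)) (PathOrCycle.deg≤2 G w)) λ { (s≤s (s≤s ())) }

-- Nested blocks and their chords

-- A block of height i starting at p is the interval [p , p + span i]; a block of height i + 1
-- consists of its first and last vertex and two consecutive blocks of height i between them.
-- Block d i p says that the block of height d starting at 0 has a sub-block of height i
-- starting at p.  The graph of height d is the path 0 … span d together with the chords
-- joining the first and last vertex of each of these blocks.
span : ℕ → ℕ
span zero    = 2
span (suc i) = suc (suc (span i) + suc (span i))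

size : ℕ → ℕ
size i = suc (span i)

last : ℕ → ℕ → ℕ
last i p = p + span i

data Block : ℕ → ℕ → ℕ → Set where
  root    : ∀ {j} → Block j j 0
  inLeft  : ∀ {j i p} → Block j i p → Block (suc j) i (suc p)
  inRight : ∀ {j i p} → Block j i p → Block (suc j) i (suc (size j + p))

2≤span : ∀ i → 2 ≤ span i
2≤span zero    = s≤s (s≤s z≤n)
2≤span (suc i) = s≤s (≤-trans (s≤s z≤n) (m≤m+n (size i) (size i)))

p<last : ∀ i p → p < last i p
p<last i p = m<m+n p (≤-trans (s≤s z≤n) (2≤span i))

p+2≤last : ∀ i p → 2 + p ≤ last i p
p+2≤last i p = subst (_≤ last i p) (+-comm p 2) (+-monoʳ-≤ p (2≤span i))

last-1<last : ∀ i p → pred (last i p) < last i p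
last-1<last i p =
  subst (pred (last i p) <_) (suc-pred (last i p) {{>-nonZero (≤-<-trans z≤n (p<last i p))}}) (n<1+n _)

last-+ : ∀ i k p → last i (k + p) ≡ k + last i p
last-+ i k p = +-assoc k p (span i)

last≤span : ∀ {j i p} → Block j i p → last i p ≤ span j
last≤span root = ≤-refl
last≤span {suc j} (inLeft B) =
  s≤s (≤-trans (last≤span B) (≤-trans (n≤1+n (span j)) (m≤m+n (size j) (size j))))
last≤span {suc j} {i} (inRight {p = p} B) =
  subst (_≤ span (suc j)) (cong suc (sym (last-+ i (size j) p)))
    (s≤s (+-monoʳ-≤ (size j) (≤-trans (last≤span B) (n≤1+n (span j)))))

child₁ : ∀ {j i p} → Block j (suc i) p → Block j i (suc p)
child₁ root                = inLeft root
child₁ (inLeft B)          = inLeft (child₁ B)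
child₁ (inRight {j} {p = p} B) = subst (Block _ _) (cong suc (+-suc (size j) p)) (inRight (child₁ B))

child₂ : ∀ {j i p} → Block j (suc i) p → Block j i (suc (last i (suc p)))
child₂ {i = i} {p} B = subst (Block _ _) (cong (suc ∘ suc) (+-comm (span i) p)) (right B)
  where
  right : ∀ {j i p} → Block j (suc i) p → Block j i (suc (size i + p))
  right root = inRight root
  right {i = i} (inLeft {p = p} B) = subst (Block _ _) (cong suc (sym (+-suc (size i) p))) (inLeft (right B))
  right {i = i} (inRight {j} {p = p} B) = subst (Block _ _) (swap (size i) (size j) p) (inRight (right B))
    where
    swap : ∀ a b c → suc (b + suc (a + c)) ≡ suc (a + suc (b + c))
    swap = solve-∀

data Laminar (p q p' q' : ℕ) : Set where
  before   : q < p'           → Laminar p q p' q'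
  after    : q' < p           → Laminar p q p' q'
  same     : p ≡ p' → q ≡ q'  → Laminar p q p' q'
  encloses : p < p' → q' < q  → Laminar p q p' q'
  enclosed : p' < p → q < q'  → Laminar p q p' q'

Laminar-+ : ∀ k {p q p' q'} → Laminar p q p' q' → Laminar (k + p) (k + q) (k + p') (k + q')
Laminar-+ k (before q<p')          = before (+-monoʳ-< k q<p')
Laminar-+ k (after q'<p)           = after (+-monoʳ-< k q'<p)
Laminar-+ k (same p≡p' q≡q')       = same (cong (k +_) p≡p') (cong (k +_) q≡q')
Laminar-+ k (encloses p<p' q'<q)   = encloses (+-monoʳ-< k p<p') (+-monoʳ-< k q'<q)
Laminar-+ k (enclosed p'<p q<q')   = enclosed (+-monoʳ-< k p'<p) (+-monoʳ-< k q<q')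

laminar : ∀ {j i p i' p'} → Block j i p → Block j i' p' → Laminar p (last i p) p' (last i' p')
laminar root root = same refl refl
laminar {suc j} root (inLeft B') =
  encloses (s≤s z≤n) (s≤s (≤-trans (s≤s (last≤span B')) (m≤m+n (size j) (size j))))
laminar {suc j} root (inRight {p = p} B') =
  encloses (s≤s z≤n) (s≤s (subst (_< size j + size j) (sym (last-+ _ (size j) p))
                                 (+-monoʳ-< (size j) (s≤s (last≤span B')))))
laminar {suc j} (inLeft B) root =
  enclosed (s≤s z≤n) (s≤s (≤-trans (s≤s (last≤span B)) (m≤m+n (size j) (size j))))
laminar {suc j} (inRight {p = p} B) root =
  enclosed (s≤s z≤n) (s≤s (subst (_< size j + size j) (sym (last-+ _ (size j) p))
                                 (+-monoʳ-< (size j) (s≤s (last≤span B)))))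
laminar (inLeft B) (inLeft B') = Laminar-+ 1 (laminar B B')
laminar {suc j} {i} {_} {i'} (inRight {p = p} B) (inRight {p = p'} B') =
  subst₂ (λ q q' → Laminar (suc (size j + p)) (suc q) (suc (size j + p')) (suc q'))
    (sym (last-+ i (size j) p)) (sym (last-+ i' (size j) p'))
    (Laminar-+ (suc (size j)) (laminar B B'))
laminar {suc j} (inLeft B) (inRight {p = p'} B') =
  before (s≤s (≤-trans (s≤s (last≤span B)) (m≤m+n (size j) p')))
laminar {suc j} (inRight {p = p} B) (inLeft B') =
  after (s≤s (≤-trans (s≤s (last≤span B')) (m≤m+n (size j) p)))

Chord : ℕ → ℕ → ℕ → Set
Chord d a b = ∃[ i ] Block d i a × b ≡ last i a

Chord-< : ∀ {d a b} → Chord d a b → a < b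
Chord-< (i , _ , refl) = p<last i _

Chord-≤span : ∀ {d a b} → Chord d a b → b ≤ span d
Chord-≤span (_ , B , refl) = last≤span B

chord-functional : ∀ {d a b b'} → Chord d a b → Chord d a b' → b ≡ b'
chord-functional (i , B , refl) (i' , B' , refl) with laminar B B'
... | before q<p'     = contradiction (<⇒≤ (p<last i _)) (<⇒≱ q<p')
... | after q'<p      = contradiction (m≤m+n _ _) (<⇒≱ q'<p)
... | same _ q≡q'     = q≡q'
... | encloses p<p' _ = contradiction refl (<⇒≢ p<p')
... | enclosed p'<p _ = contradiction refl (<⇒≢ p'<p)

chord-injective : ∀ {d a a' b} → Chord d a b → Chord d a' b → a ≡ a'
chord-injective {a = a} {a'} (i , B , refl) (i' , B' , e) with laminar B B'
... | before q<p'     = contradiction (≤-trans (m≤m+n a' _) (≤-reflexive (sym e))) (<⇒≱ q<p')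
... | after q'<p      = contradiction (m≤m+n a _) (<⇒≱ (subst (_< a) (sym e) q'<p))
... | same p≡p' _     = p≡p'
... | encloses _ q'<q = contradiction (sym e) (<⇒≢ q'<q)
... | enclosed _ q<q' = contradiction e (<⇒≢ q<q')

no-chord-chain : ∀ {d a b c} → Chord d a b → ¬ Chord d b c
no-chord-chain (i , B , refl) (i' , B' , refl) with laminar B B'
... | before q<p'     = <-irrefl refl q<p'
... | after q'<p      = <⇒≱ q'<p (≤-trans (m≤m+n _ _) (m≤m+n _ _))
... | same p≡p' _     = <-irrefl p≡p' (p<last i _)
... | encloses _ q'<q = <⇒≱ q'<q (m≤m+n _ _)
... | enclosed p'<p _ = <⇒≱ p'<p (m≤m+n _ _)

rootChord : ℕ → ℕ → ℕ → Bool
rootChord j a b = does (a ≟ 0) ∧ does (b ≟ span j)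

isChord : ℕ → ℕ → ℕ → Bool
shiftedChord : ℕ → ℕ → ℕ → ℕ → Bool

isChord zero    a b = rootChord zero a b
isChord (suc j) a b = rootChord (suc j) a b ∨ shiftedChord j 1 a b ∨ shiftedChord j (suc (size j)) a b

shiftedChord j k a b = does (k ≤? a) ∧ isChord j (a ∸ k) (b ∸ k)

∸-last : ∀ k i {a b} → k ≤ a → b ∸ k ≡ last i (a ∸ k) → b ≡ last i a
∸-last k i {a} {b} k≤a eq = begin
  b                    ≡⟨ sym (m+[n∸m]≡n k≤b) ⟩
  k + (b ∸ k)          ≡⟨ cong (k +_) eq ⟩
  k + last i (a ∸ k)   ≡⟨ sym (last-+ i k (a ∸ k)) ⟩
  last i (k + (a ∸ k)) ≡⟨ cong (last i) (m+[n∸m]≡n k≤a) ⟩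
  last i a             ∎
  where
  open ≡-Reasoning
  k≤b : k ≤ b
  k≤b = <⇒≤ (m∸n≢0⇒n<m λ b∸k≡0 →
          <⇒≢ (≤-<-trans z≤n (p<last i (a ∸ k))) (sym (trans (sym eq) b∸k≡0)))

rootChord-sound : ∀ j a b → rootChord j a b ≡ true → Chord j a b
rootChord-sound j a b h with a≡0 , b≡span ← ∧≡true⇒ h
  rewrite does≡true⇒ (a ≟ 0) a≡0 | does≡true⇒ (b ≟ span j) b≡span = j , root , refl

Chord-shift : ∀ {j} k → (∀ {i p} → Block j i p → Block (suc j) i (k + p)) →
  ∀ {a b} → k ≤ a → Chord j (a ∸ k) (b ∸ k) → Chord (suc j) a b
Chord-shift k embed k≤a (i , B , eq) =
  i , subst (Block _ i) (m+[n∸m]≡n k≤a) (embed B) , ∸-last k i k≤a eq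

isChord-sound : ∀ j a b → isChord j a b ≡ true → Chord j a b
isChord-sound zero a b h = rootChord-sound zero a b h
isChord-sound (suc j) a b h with ∨≡true⇒ h
... | inj₁ h₀ = rootChord-sound (suc j) a b h₀
... | inj₂ h₁ with ∨≡true⇒ h₁
...   | inj₁ hˡ with k≤a , c ← ∧≡true⇒ hˡ =
        Chord-shift 1 inLeft (does≡true⇒ (1 ≤? a) k≤a) (isChord-sound j _ _ c)
...   | inj₂ hʳ with k≤a , c ← ∧≡true⇒ hʳ =
        Chord-shift (suc (size j)) inRight (does≡true⇒ (suc (size j) ≤? a) k≤a) (isChord-sound j _ _ c)

isChord-complete : ∀ {j i a} → Block j i a → isChord j a (last i a) ≡ true
isChord-complete {zero} root = refl
isChord-complete {suc j} root = ∨≡trueˡ _ (dec-true (span (suc j) ≟ span (suc j)) refl)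
isChord-complete {suc j} {i} (inLeft {p = p} B) =
  ∨≡trueʳ (rootChord (suc j) (suc p) (last i (suc p)))
    (∨≡trueˡ (shiftedChord j (suc (size j)) (suc p) (last i (suc p))) (isChord-complete B))
isChord-complete {suc j} {i} (inRight {p = p} B) =
  ∨≡trueʳ (rootChord (suc j) a (last i a)) (∨≡trueʳ (shiftedChord j 1 a (last i a))
    (subst₂ (λ x y → does (suc (size j) ≤? a) ∧ isChord j x y ≡ true)
      (sym (m+n∸m≡n (size j) p))
      (sym (trans (cong (_∸ size j) (last-+ i (size j) p)) (m+n∸m≡n (size j) (last i p))))
      (cong₂ _∧_ (dec-true (suc (size j) ≤? a) (s≤s (m≤m+n (size j) p))) (isChord-complete B))))
  where
  a = suc (size j + p)

adjacent : ℕ → ℕ → ℕ → Bool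
adjacent d a b = does (suc a ≟ b) ∨ does (suc b ≟ a) ∨ isChord d a b ∨ isChord d b a

data Adjacency (d a b : ℕ) : Set where
  next    : suc a ≡ b   → Adjacency d a b
  prev    : suc b ≡ a   → Adjacency d a b
  chord   : Chord d a b → Adjacency d a b
  chord⁻¹ : Chord d b a → Adjacency d a b

adjacency : ∀ {d a b} → adjacent d a b ≡ true → Adjacency d a b
adjacency {d} {a} {b} h with ∨≡true⇒ h
... | inj₁ h₁ = next (does≡true⇒ (suc a ≟ b) h₁)
... | inj₂ h₁ with ∨≡true⇒ h₁
...   | inj₁ h₂ = prev (does≡true⇒ (suc b ≟ a) h₂)
...   | inj₂ h₂ with ∨≡true⇒ h₂
...     | inj₁ h₃ = chord (isChord-sound d a b h₃)
...     | inj₂ h₃ = chord⁻¹ (isChord-sound d b a h₃)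

adjacent-sym : ∀ d a b → adjacent d a b ≡ adjacent d b a
adjacent-sym d a b = swap (does (suc a ≟ b)) (does (suc b ≟ a)) (isChord d a b) (isChord d b a)
  where
  swap : ∀ x y z w → x ∨ y ∨ z ∨ w ≡ y ∨ x ∨ w ∨ z
  swap true  true  _ _ = refl
  swap true  false _ _ = refl
  swap false true  _ _ = refl
  swap false false z w = ∨-comm z w

adjacent-irrefl : ∀ d a → adjacent d a a ≡ false
adjacent-irrefl d a with adjacent d a a in loop
... | false = refl
... | true with adjacency {d} {a} {a} loop
...   | next    eq = contradiction eq (<⇒≢ ≤-refl ∘ sym)
...   | prev    eq = contradiction eq (<⇒≢ ≤-refl ∘ sym)
...   | chord   c  = contradiction (Chord-< c) (<-irrefl refl)
...   | chord⁻¹ c  = contradiction (Chord-< c) (<-irrefl refl)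

adjacent-next : ∀ d a → adjacent d a (suc a) ≡ true
adjacent-next d a = ∨≡trueˡ _ (dec-true (suc a ≟ suc a) refl)

adjacent-chord : ∀ {d a b} → Chord d a b → adjacent d a b ≡ true
adjacent-chord {d} {a} {b} (i , B , refl) =
  ∨≡trueʳ (does (suc a ≟ b)) (∨≡trueʳ (does (suc b ≟ a)) (∨≡trueˡ _ (isChord-complete B)))

walk : ∀ {A : Set} (R : A → A → Set) (f : ℕ → A) {lo hi} →
  (∀ i → lo ≤ i → i < hi → R (f i) (f (suc i))) → lo ≤ hi → Star R (f lo) (f hi)
walk R f {lo} {zero} step z≤n = ε
walk R f {lo} {suc h} step lo≤1+h with m≤n⇒m<n∨m≡n lo≤1+h
... | inj₂ refl = ε
... | inj₁ (s≤s lo≤h) =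
  walk R f (λ i lo≤i i<h → step i lo≤i (m<n⇒m<1+n i<h)) lo≤h ◅◅ (step h lo≤h ≤-refl ◅ ε)

module Nested (d : ℕ) where

  N : ℕ
  N = size d

  G : Graph
  G = record
    { n          = N
    ; adj        = λ u v → adjacent d (toℕ u) (toℕ v)
    ; adj-sym    = λ u v → adjacent-sym d (toℕ u) (toℕ v)
    ; adj-irrefl = λ v → adjacent-irrefl d (toℕ v)
    }

  -- Junk value Fin.zero outside 0 … span d.
  vertex : ℕ → Fin N
  vertex a with a <? N
  ... | yes a<N = fromℕ< a<N
  ... | no  _   = Fin.zero

  toℕ-vertex : ∀ {a} → a < N → toℕ (vertex a) ≡ a
  toℕ-vertex {a} a<N with a <? N
  ... | yes _   = Finₚ.toℕ-fromℕ< _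
  ... | no  a≮N = contradiction a<N a≮N

  vertex-toℕ : ∀ u → vertex (toℕ u) ≡ u
  vertex-toℕ u = Finₚ.toℕ-injective (toℕ-vertex (Finₚ.toℕ<n u))

  vertex-≢ : ∀ {a} u → a < N → a ≢ toℕ u → vertex a ≢ u
  vertex-≢ u a<N a≢u eq = a≢u (trans (sym (toℕ-vertex a<N)) (cong toℕ eq))

  vertex-injective : ∀ {a b} → a < N → b < N → a ≢ b → vertex a ≢ vertex b
  vertex-injective {b = b} a<N b<N a≢b = vertex-≢ (vertex b) a<N (a≢b ∘ flip trans (toℕ-vertex b<N))

  adjacent⇒Edge : ∀ {a b} → a < N → b < N → adjacent d a b ≡ true → Edge G (vertex a) (vertex b)
  adjacent⇒Edge a<N b<N a∼b rewrite toℕ-vertex a<N | toℕ-vertex b<N = a∼b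

  next-edge : ∀ {a} → suc a < N → Edge G (vertex a) (vertex (suc a))
  next-edge {a} 1+a<N = adjacent⇒Edge (<-trans (n<1+n a) 1+a<N) 1+a<N (adjacent-next d a)

  chord-edge : ∀ {a b} → Chord d a b → Edge G (vertex a) (vertex b)
  chord-edge c = adjacent⇒Edge (<-trans (Chord-< c) b<N) b<N (adjacent-chord c)
    where
    b<N = s≤s (Chord-≤span c)

  Edge-sym : ∀ {u v} → Edge G u v → Edge G v u
  Edge-sym {u} {v} = trans (adjacent-sym d (toℕ v) (toℕ u))

  no-crossing : ∀ {a b c e} → adjacent d a b ≡ true → adjacent d c e ≡ true →
    a < c → c < b → b < e → ⊥
  no-crossing {a} {b} {c} {e} a∼b c∼e a<c c<b b<e with adjacency {d} {a} {b} a∼b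
  ... | next refl    = <⇒≱ c<b a<c
  ... | prev refl    = <-asym (<-trans a<c c<b) (n<1+n _)
  ... | chord⁻¹ c    = <-asym (<-trans a<c c<b) (Chord-< c)
  ... | chord cab with adjacency {d} {c} {e} c∼e
  ...   | next refl  = <⇒≱ b<e c<b
  ...   | prev refl  = <-asym (<-trans c<b b<e) (n<1+n _)
  ...   | chord⁻¹ c  = <-asym (<-trans c<b b<e) (Chord-< c)
  ...   | chord cce with cab | cce
  ...     | i , B , refl | i' , B' , refl with laminar B B'
  ...       | before q<p'     = <-asym q<p' c<b
  ...       | after q'<p      = <-asym q'<p (<-trans a<c (<-trans c<b b<e))
  ...       | same p≡p' _     = <-irrefl p≡p' a<c
  ...       | encloses _ q'<q = <-asym q'<q b<e
  ...       | enclosed p'<p _ = <-asym p'<p a<c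

  outerplanar : Outerplanar G
  outerplanar = toℕ , Finₚ.toℕ-injective ,
    λ a b c e ab ce (a<c , c<b , b<e) → no-crossing ab ce a<c c<b b<e

  walk-in : ∀ (R : Fin N → Fin N → Set) {lo hi} → hi < N →
    (∀ i → suc i < N → lo ≤ i → i < hi → Edge G (vertex i) (vertex (suc i)) → R (vertex i) (vertex (suc i))) →
    lo ≤ hi → Star R (vertex lo) (vertex hi)
  walk-in R hi<N step = walk R vertex λ i lo≤i i<hi →
    step i (≤-<-trans i<hi hi<N) lo≤i i<hi (next-edge (≤-<-trans i<hi hi<N))

  connected : Connected G
  connected u v = subst₂ (Star (Edge G)) (vertex-toℕ u) (vertex-toℕ v)
    (Star.reverse (λ {x} {y} → Edge-sym {x} {y}) (along u) ◅◅ along v)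
    where
    along : ∀ u → Star (Edge G) (vertex 0) (vertex (toℕ u))
    along u = walk-in (Edge G) (Finₚ.toℕ<n u) (λ _ _ _ _ e → e) z≤n

  Avoiding : Fin N → Fin N → Fin N → Set
  Avoiding x a b = Edge G a b × a ≢ x × b ≢ x

  Avoiding-sym : ∀ x {a b} → Avoiding x a b → Avoiding x b a
  Avoiding-sym x {a} {b} (ab , a≢x , b≢x) = Edge-sym {a} {b} ab , b≢x , a≢x

  walk-avoiding : ∀ x {lo hi} → hi < N → ¬ (lo ≤ toℕ x × toℕ x ≤ hi) → lo ≤ hi →
    Star (Avoiding x) (vertex lo) (vertex hi)
  walk-avoiding x {lo} {hi} hi<N x∉ = walk-in (Avoiding x) hi<N λ i 1+i<N lo≤i i<hi e →
    e , vertex-≢ x (<-trans (n<1+n i) 1+i<N)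
          (λ i≡x → x∉ (subst (lo ≤_) i≡x lo≤i , subst (_≤ hi) i≡x (<⇒≤ i<hi)))
      , vertex-≢ x 1+i<N
          (λ 1+i≡x → x∉ (subst (lo ≤_) 1+i≡x (m≤n⇒m≤1+n lo≤i) , subst (_≤ hi) 1+i≡x i<hi))

  -- If x separates a from b on the path 0 … span d, go around through the root chord instead.
  avoiding-path : ∀ x {a b} → a ≤ b → b < N → a ≢ toℕ x → b ≢ toℕ x →
    Star (Avoiding x) (vertex a) (vertex b)
  avoiding-path x {a} {b} a≤b b<N a≢x b≢x with a ≤? toℕ x | toℕ x ≤? b
  ... | yes a≤x | yes x≤b =
    Star.reverse (Avoiding-sym x) (walk-avoiding x (≤-<-trans a≤b b<N) (λ (_ , x≤a) → <⇒≱ a<x x≤a) z≤n)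
    ◅◅ (chord-edge (d , root , refl) , vertex-≢ x (s≤s z≤n) (<⇒≢ (≤-<-trans z≤n a<x))
                                     , vertex-≢ x ≤-refl (<⇒≢ (<-≤-trans x<b (≤-pred b<N)) ∘ sym))
    ◅ Star.reverse (Avoiding-sym x) (walk-avoiding x ≤-refl (λ (b≤x , _) → <⇒≱ x<b b≤x) (≤-pred b<N))
    where
    a<x = ≤∧≢⇒< a≤x a≢x
    x<b = ≤∧≢⇒< x≤b (b≢x ∘ sym)
  ... | no a≰x | _       = walk-avoiding x b<N (λ (a≤x , _) → a≰x a≤x) a≤b
  ... | _      | no x≰b  = walk-avoiding x b<N (λ (_ , x≤b) → x≰b x≤b) a≤b

  twoConnected : TwoConnected G
  twoConnected = s≤s (2≤span d) , connected , λ x u v u≢x v≢x →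
    subst₂ (Star (Avoiding x)) (vertex-toℕ u) (vertex-toℕ v) (around x u v u≢x v≢x)
    where
    toℕ-≢ : ∀ {u x : Fin N} → u ≢ x → toℕ u ≢ toℕ x
    toℕ-≢ u≢x = u≢x ∘ Finₚ.toℕ-injective
    around : ∀ x u v → u ≢ x → v ≢ x → Star (Avoiding x) (vertex (toℕ u)) (vertex (toℕ v))
    around x u v u≢x v≢x with ≤-total (toℕ u) (toℕ v)
    ... | inj₁ u≤v = avoiding-path x u≤v (Finₚ.toℕ<n v) (toℕ-≢ u≢x) (toℕ-≢ v≢x)
    ... | inj₂ v≤u = Star.reverse (Avoiding-sym x)
                       (avoiding-path x v≤u (Finₚ.toℕ<n u) (toℕ-≢ v≢x) (toℕ-≢ u≢x))

  count-positions : (p : Fin N → Bool) {ws : List ℕ} → AllPairs _≢_ ws → All (_< N) ws →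
    (∀ y → p y ≡ true → toℕ y ∈ ws) → count p ≡ sum (map (bit ∘ p ∘ vertex) ws)
  count-positions p {ws} distinct bounded support =
    trans (count-support p (unique distinct bounded) support′) (cong sum (sym (map-∘ ws)))
    where
    unique : ∀ {ws} → AllPairs _≢_ ws → All (_< N) ws → Unique (map vertex ws)
    unique [] [] = []
    unique {w ∷ _} (w≢ws ∷ distinct) (w<N ∷ bounded) = apart w≢ws bounded ∷ unique distinct bounded
      where
      apart : ∀ {vs} → All (w ≢_) vs → All (_< N) vs → All (vertex w ≢_) (map vertex vs)
      apart [] [] = []
      apart (w≢v ∷ w≢vs) (v<N ∷ vs<N) = vertex-injective w<N v<N w≢v ∷ apart w≢vs vs<N
    support′ : ∀ y → p y ≡ true → y ∈ map vertex ws
    support′ y py = subst (_∈ map vertex ws) (vertex-toℕ y) (∈-map⁺ vertex (support y py))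

  degree≤3 : ∀ v → degree G v ≤ 3
  degree≤3 v = subst (_≤ 3) (sym (degreeIn≡count (adj G) v))
    (≤-trans (count-∨ successor (λ y → predecessor y ∨ partner y)) (+-mono-≤ (count≤1 successor one-successor)
      (≤-trans (count-∨ predecessor partner) (+-mono-≤ (count≤1 predecessor one-predecessor)
        (count≤1 partner one-partner)))))
    where
    a = toℕ v
    successor predecessor partner : Fin N → Bool
    successor   y = does (suc a ≟ toℕ y)
    predecessor y = does (suc (toℕ y) ≟ a)
    partner     y = isChord d a (toℕ y) ∨ isChord d (toℕ y) a
    one-successor : ∀ x y → successor x ≡ true → successor y ≡ true → x ≡ y
    one-successor x y sx sy = Finₚ.toℕ-injective
      (trans (sym (does≡true⇒ (suc a ≟ toℕ x) sx)) (does≡true⇒ (suc a ≟ toℕ y) sy))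
    one-predecessor : ∀ x y → predecessor x ≡ true → predecessor y ≡ true → x ≡ y
    one-predecessor x y px py = Finₚ.toℕ-injective (suc-injective
      (trans (does≡true⇒ (suc (toℕ x) ≟ a) px) (sym (does≡true⇒ (suc (toℕ y) ≟ a) py))))
    sound : ∀ {a b} → isChord d a b ≡ true → Chord d a b
    sound = isChord-sound d _ _
    one-partner : ∀ x y → partner x ≡ true → partner y ≡ true → x ≡ y
    one-partner x y cx cy with ∨≡true⇒ cx | ∨≡true⇒ cy
    ... | inj₁ c₁ | inj₁ c₂ = Finₚ.toℕ-injective (chord-functional (sound c₁) (sound c₂))
    ... | inj₂ c₁ | inj₂ c₂ = Finₚ.toℕ-injective (chord-injective (sound c₁) (sound c₂))
    ... | inj₁ c₁ | inj₂ c₂ = contradiction (sound c₁) (no-chord-chain (sound c₂))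
    ... | inj₂ c₁ | inj₁ c₂ = contradiction (sound c₂) (no-chord-chain (sound c₁))

maxDegree : ∀ {d} → 1 ≤ d → MaxDegree (Nested.G d) 3
maxDegree {suc d} _ = degree≤3 , vertex 1 , degree-1
  where
  open Nested (suc d)
  s = size d
  1<N : 1 < N
  1<N = s≤s (s≤s z≤n)
  s<N : s < N
  s<N = s≤s (≤-trans (n≤1+n s) (m≤m+n (suc s) s))
  3≤s : 3 ≤ s
  3≤s = s≤s (2≤span d)
  chord-1-s : Chord (suc d) 1 s
  chord-1-s = d , inLeft root , refl
  neighbours : ∀ y → Edge G (vertex 1) y → toℕ y ∈ (0 ∷ 2 ∷ s ∷ [])
  neighbours y 1∼y rewrite toℕ-vertex 1<N with adjacency {suc d} {1} {toℕ y} 1∼y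
  ... | next 2≡y  = there (here (sym 2≡y))
  ... | prev 1+y≡1 = here (suc-injective 1+y≡1)
  ... | chord c   = there (there (here (chord-functional c chord-1-s)))
  ... | chord⁻¹ c = contradiction chord-1-s (no-chord-chain c)
  degree-1 : degree G (vertex 1) ≡ 3
  degree-1 rewrite degreeIn≡count (adj G) (vertex 1)
                 | count-positions (adj G (vertex 1))
                     (((λ ()) ∷ (<⇒≢ (≤-trans (s≤s z≤n) 3≤s)) ∷ []) ∷ ((<⇒≢ 3≤s) ∷ []) ∷ [] ∷ [])
                     (≤-trans (s≤s z≤n) 1<N ∷ <-trans 3≤s s<N ∷ s<N ∷ [])
                     neighbours
                 | adjacent⇒Edge 1<N (s≤s z≤n) refl
                 | adjacent⇒Edge 1<N (<-trans 3≤s s<N) refl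
                 | adjacent⇒Edge 1<N s<N (adjacent-chord chord-1-s) = refl

module _ {d : ℕ} where

  leaving-interior : ∀ {j q u v} → Block d j q → adjacent d u v ≡ true → q < u → u < last j q →
    ¬ (q < v × v < last j q) → (u ≡ suc q × v ≡ q) ⊎ (suc u ≡ last j q × v ≡ last j q)
  leaving-interior {j} {q} {u} {v} B u∼v q<u u<l v∉ with adjacency {d} {u} {v} u∼v
  ... | next refl with <-cmp (suc u) (last j q)
  ...   | tri< 1+u<l _ _ = contradiction (<-trans q<u (n<1+n u) , 1+u<l) v∉
  ...   | tri≈ _ 1+u≡l _ = inj₂ (1+u≡l , 1+u≡l)
  ...   | tri> _ _ l<1+u = contradiction u<l (<⇒≱ l<1+u)
  leaving-interior {j} {q} {u} {v} B u∼v q<u u<l v∉ | prev refl with <-cmp q v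
  ...   | tri< q<v _ _ = contradiction (q<v , <-trans (n<1+n v) u<l) v∉
  ...   | tri≈ _ q≡v _ = inj₁ (cong suc (sym q≡v) , sym q≡v)
  ...   | tri> _ _ v<q = contradiction v<q (<⇒≱ q<u)
  leaving-interior {j} {q} {u} {v} B u∼v q<u u<l v∉ | chord (i , B' , refl) with laminar B B'
  ...   | before l<u       = contradiction u<l (<-asym l<u)
  ...   | after v<q        = contradiction v<q (<-asym (<-trans q<u (p<last i u)))
  ...   | same q≡u _       = contradiction q≡u (<⇒≢ q<u)
  ...   | encloses _ v<l   = contradiction (<-trans q<u (p<last i u) , v<l) v∉
  ...   | enclosed u<q _   = contradiction u<q (<-asym q<u)
  leaving-interior {j} {q} {u} {v} B u∼v q<u u<l v∉ | chord⁻¹ (i , B' , refl) with laminar B B'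
  ...   | before l<v       = contradiction (<-trans l<v (p<last i v)) (<-asym u<l)
  ...   | after u<q        = contradiction u<q (<-asym q<u)
  ...   | same _ l≡u       = contradiction (sym l≡u) (<⇒≢ u<l)
  ...   | encloses q<v _   = contradiction (q<v , <-trans (p<last i v) u<l) v∉
  ...   | enclosed _ l<u   = contradiction l<u (<-asym u<l)

  leaving-block : ∀ {j q u v} → Block d j q → adjacent d u v ≡ true → q ≤ u → u ≤ last j q →
    ¬ (q ≤ v × v ≤ last j q) → (suc v ≡ q × u ≡ q) ⊎ (u ≡ last j q × v ≡ suc (last j q))
  leaving-block {j} {q} {u} {v} B u∼v q≤u u≤l v∉ with adjacency {d} {u} {v} u∼v
  ... | next refl with <-cmp u (last j q)
  ...   | tri< u<l _ _ = contradiction (≤-trans q≤u (n≤1+n u) , u<l) v∉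
  ...   | tri≈ _ u≡l _ = inj₂ (u≡l , cong suc u≡l)
  ...   | tri> _ _ l<u = contradiction u≤l (<⇒≱ l<u)
  leaving-block {j} {q} {u} {v} B u∼v q≤u u≤l v∉ | prev refl with <-cmp v q
  ...   | tri< v<q _ _ = inj₁ (≤-antisym v<q q≤u , ≤-antisym v<q q≤u)
  ...   | tri≈ _ v≡q _ = contradiction (≤-reflexive (sym v≡q) , ≤-trans (n≤1+n v) u≤l) v∉
  ...   | tri> _ _ q<v = contradiction (<⇒≤ q<v , ≤-trans (n≤1+n v) u≤l) v∉
  leaving-block {j} {q} {u} {v} B u∼v q≤u u≤l v∉ | chord (i , B' , refl) with laminar B B'
  ...   | before l<u       = contradiction u≤l (<⇒≱ l<u)
  ...   | after v<q        = contradiction (≤-trans q≤u (<⇒≤ (p<last i u))) (<⇒≱ v<q)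
  ...   | same _ l≡v       = contradiction (≤-trans q≤u (<⇒≤ (p<last i u)) , ≤-reflexive (sym l≡v)) v∉
  ...   | encloses _ v<l   = contradiction (≤-trans q≤u (<⇒≤ (p<last i u)) , <⇒≤ v<l) v∉
  ...   | enclosed u<q _   = contradiction q≤u (<⇒≱ u<q)
  leaving-block {j} {q} {u} {v} B u∼v q≤u u≤l v∉ | chord⁻¹ (i , B' , refl) with laminar B B'
  ...   | before l<v       = contradiction u≤l (<⇒≱ (<-trans l<v (p<last i v)))
  ...   | after u<q        = contradiction q≤u (<⇒≱ u<q)
  ...   | same q≡v _       = contradiction (≤-reflexive q≡v , ≤-trans (<⇒≤ (p<last i v)) u≤l) v∉
  ...   | encloses q<v _   = contradiction (<⇒≤ q<v , ≤-trans (<⇒≤ (p<last i v)) u≤l) v∉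
  ...   | enclosed _ l<u   = contradiction u≤l (<⇒≱ l<u)

  neighbours-start : ∀ {j s v} → Block d j s → adjacent d s v ≡ true →
    suc v ≡ s ⊎ v ≡ suc s ⊎ v ≡ last j s
  neighbours-start {j} {s} {v} B s∼v with adjacency {d} {s} {v} s∼v
  ... | next s+1≡v = inj₂ (inj₁ (sym s+1≡v))
  ... | prev v+1≡s = inj₁ v+1≡s
  ... | chord c    = inj₂ (inj₂ (chord-functional c (j , B , refl)))
  ... | chord⁻¹ c  = contradiction (j , B , refl) (no-chord-chain c)

  neighbours-last : ∀ {j s v} → Block d j s → adjacent d (last j s) v ≡ true →
    suc v ≡ last j s ⊎ v ≡ suc (last j s) ⊎ v ≡ s
  neighbours-last {j} {s} {v} B l∼v with adjacency {d} {last j s} {v} l∼v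
  ... | next l+1≡v = inj₂ (inj₁ (sym l+1≡v))
  ... | prev v+1≡l = inj₁ v+1≡l
  ... | chord c    = contradiction c (no-chord-chain (j , B , refl))
  ... | chord⁻¹ c  = inj₂ (inj₂ (chord-injective c (j , B , refl)))

  neighbours-leaf-middle : ∀ {s v} → Block d 0 s → adjacent d (suc s) v ≡ true → v ≡ s ⊎ v ≡ last 0 s
  neighbours-leaf-middle {s} {v} B m∼v with adjacency {d} {suc s} {v} m∼v
  ... | next m+1≡v = inj₂ (trans (sym m+1≡v) (+-comm 2 s))
  ... | prev v+1≡m = inj₁ (suc-injective v+1≡m)
  ... | chord (i , B' , refl) with laminar B B'
  ...   | before s+2<m     = contradiction s+2<m (<-asym (subst (suc s <_) (+-comm 2 s) ≤-refl))
  ...   | after e<s        = contradiction e<s (<-asym (<-trans (n<1+n s) (p<last i (suc s))))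
  ...   | same s≡m _       = contradiction s≡m (<⇒≢ (n<1+n s))
  ...   | encloses _ e<s+2 = contradiction e<s+2
                              (≤⇒≯ (subst (_≤ last i (suc s)) (+-comm 2 s)
                                           (≤-trans (n≤1+n _) (p+2≤last i (suc s)))))
  ...   | enclosed m<s _   = contradiction m<s (<-asym (n<1+n s))
  neighbours-leaf-middle {s} {v} B m∼v | chord⁻¹ (i , B' , m≡e) with laminar B B'
  ...   | before l<v       = contradiction (subst (v <_) (sym m≡e) (p<last i v))
                              (<-asym (<-trans (subst (suc s <_) (+-comm 2 s) ≤-refl) l<v))
  ...   | after e<s        = contradiction (subst (_< s) (sym m≡e) e<s) (<-asym (n<1+n s))
  ...   | same s≡v _       = contradiction (trans m≡e (cong (last i) (sym s≡v))) (<⇒≢ (p+2≤last i s))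
  ...   | encloses s<v _   = contradiction (subst (v <_) (sym m≡e) (p<last i v)) (≤⇒≯ s<v)
  ...   | enclosed _ l<e   = contradiction (≤-trans (n≤1+n (suc s)) (≤-reflexive (+-comm 2 s)))
                              (<⇒≱ (subst (last 0 s <_) (sym m≡e) l<e))

-- Local configurations

infixr 4 _⇒ᵇ_
_⇒ᵇ_ : Bool → Bool → Bool
x ⇒ᵇ y = not x ∨ y

⇒ᵇ-elim : ∀ {x y} → (x ⇒ᵇ y) ≡ true → x ≡ true → y ≡ true
⇒ᵇ-elim h refl = h

⇒ᵇ-intro : ∀ {x y} → (x ≡ true → y ≡ false → ⊥) → (x ⇒ᵇ y) ≡ true
⇒ᵇ-intro {false}        _      = refl
⇒ᵇ-intro {true} {true}  _      = refl
⇒ᵇ-intro {true} {false} absurd = ⊥-elim (absurd refl refl)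

∀ᵇ : ∀ n → (Vec Bool n → Bool) → Bool
∀ᵇ zero    f = f []
∀ᵇ (suc n) f = ∀ᵇ n (f ∘ (true ∷_)) ∧ ∀ᵇ n (f ∘ (false ∷_))

∀ᵇ-sound : ∀ n (f : Vec Bool n → Bool) → ∀ᵇ n f ≡ true → ∀ v → f v ≡ true
∀ᵇ-sound zero    f h []          = h
∀ᵇ-sound (suc n) f h (true  ∷ v) = ∀ᵇ-sound n _ (proj₁ (∧≡true⇒ h)) v
∀ᵇ-sound (suc n) f h (false ∷ v) = ∀ᵇ-sound n _ (proj₂ (∧≡true⇒ {∀ᵇ n (f ∘ (true ∷_))} h)) v

∀≤2 : (ℕ → Bool) → Bool
∀≤2 f = f 0 ∧ f 1 ∧ f 2

∀≤2-sound : ∀ f → ∀≤2 f ≡ true → ∀ k → k ≤ 2 → f k ≡ true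
∀≤2-sound f h 0 _ = proj₁ (∧≡true⇒ h)
∀≤2-sound f h 1 _ = proj₁ (∧≡true⇒ (proj₂ (∧≡true⇒ {f 0} h)))
∀≤2-sound f h 2 _ = proj₂ (∧≡true⇒ {f 1} (proj₂ (∧≡true⇒ {f 0} h)))
∀≤2-sound f h (suc (suc (suc k))) (s≤s (s≤s ()))

isOne : ℕ → Bool
isOne n = does (n ≟ 1)

2∣isOne+ : ∀ {n} → n ≤ 2 → 2 ∣ bit (isOne n) + n
2∣isOne+ {0} _ = m∣m*n 0
2∣isOne+ {1} _ = m∣m*n 1
2∣isOne+ {2} _ = m∣m*n 1
2∣isOne+ {suc (suc (suc _))} (s≤s (s≤s ()))

-- What a subgraph of maximum degree 2 looks like around the two children of a block of height
-- j + 1 at q, whose vertices are q, A₁ … B₁ (first child), A₂ … B₂ (second child) and B₂ + 1: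
-- oᵢ are the path edges q A₁, B₁ A₂ and B₂ (B₂ + 1), cᵢ the chords of the children, pᵢ and qᵢ
-- the first and last path edges inside child i, iᵢ whether child i contains another edge of the
-- subgraph, and kᵢ the number of its ends strictly inside child i.
record Local : Set where
  field
    o₁ c₁ p₁ q₁ o₂ c₂ p₂ q₂ o₃ i₁ i₂ : Bool
    k₁ k₂ : ℕ

  deg-A₁ deg-B₁ deg-A₂ deg-B₂ : ℕ
  deg-A₁ = bit o₁ + bit c₁ + bit p₁
  deg-B₁ = bit c₁ + bit o₂ + bit q₁
  deg-A₂ = bit o₂ + bit c₂ + bit p₂
  deg-B₂ = bit c₂ + bit o₃ + bit q₂

  new-ends : ℕ
  new-ends = bit (isOne deg-A₁) + bit (isOne deg-B₁) + (bit (isOne deg-A₂) + bit (isOne deg-B₂))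

  ends : ℕ
  ends = new-ends + k₁ + k₂

  touched₁ touched₂ : Bool
  touched₁ = i₁ ∨ p₁ ∨ q₁
  touched₂ = i₂ ∨ p₂ ∨ q₂

  weight-bound : ℕ
  weight-bound = bit c₁ + bit c₂ + bit touched₁ * (k₁ + 1) + bit touched₂ * (k₂ + 1)

  -- The implications: a connected subgraph reaching both sides of a child's boundary uses an
  -- edge across it.
  admissible : Bool
  admissible =
    does (deg-A₁ ≤? 2) ∧ does (deg-B₁ ≤? 2) ∧ does (deg-A₂ ≤? 2) ∧ does (deg-B₂ ≤? 2) ∧
    (i₁ ∧ o₂ ⇒ᵇ p₁ ∨ q₁) ∧ (i₂ ∧ o₂ ⇒ᵇ p₂ ∨ q₂) ∧
    ((touched₁ ∨ c₁) ∧ c₂ ⇒ᵇ o₁ ∨ o₂) ∧ ((touched₂ ∨ c₂) ∧ c₁ ⇒ᵇ o₃ ∨ o₂) ∧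
    does (2 ∣? k₁ + bit p₁ + bit q₁) ∧ does (2 ∣? k₂ + bit p₂ + bit q₂) ∧
    (not touched₁ ⇒ᵇ does (k₁ ≟ 0)) ∧ (not touched₂ ⇒ᵇ does (k₂ ≟ 0))

  -- Handshaking around the two children: the ends and boundary edges of each child have even
  -- total, and so do the four vertices A₁, B₁, A₂, B₂.
  parity : deg-A₁ ≤ 2 → deg-B₁ ≤ 2 → deg-A₂ ≤ 2 → deg-B₂ ≤ 2 →
    2 ∣ k₁ + bit p₁ + bit q₁ → 2 ∣ k₂ + bit p₂ + bit q₂ → 2 ∣ ends + bit o₁ + bit o₃
  parity dA₁ dB₁ dA₂ dB₂ child₁ child₂ = ∣m+n∣m⇒∣n (subst (2 ∣_) handshake total) (m∣m*n shared)
    where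
    shared = bit c₁ + bit c₂ + bit o₂ + bit p₁ + bit q₁ + bit p₂ + bit q₂
    total = ∣m∣n⇒∣m+n (∣m∣n⇒∣m+n (∣m∣n⇒∣m+n (∣m∣n⇒∣m+n (∣m∣n⇒∣m+n
              (2∣isOne+ dA₁) (2∣isOne+ dB₁)) (2∣isOne+ dA₂)) (2∣isOne+ dB₂)) child₁) child₂
    handshake′ : ∀ e₁ e₂ e₃ e₄ o₁ c₁ p₁ q₁ o₂ c₂ p₂ q₂ o₃ k₁ k₂ →
      e₁ + (o₁ + c₁ + p₁) + (e₂ + (c₁ + o₂ + q₁)) + (e₃ + (o₂ + c₂ + p₂)) + (e₄ + (c₂ + o₃ + q₂))
        + (k₁ + p₁ + q₁) + (k₂ + p₂ + q₂)
      ≡ 2 * (c₁ + c₂ + o₂ + p₁ + q₁ + p₂ + q₂) + (e₁ + e₂ + (e₃ + e₄) + k₁ + k₂ + o₁ + o₃)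
    handshake′ = solve-∀
    handshake = handshake′ (bit (isOne deg-A₁)) (bit (isOne deg-B₁)) (bit (isOne deg-A₂)) (bit (isOne deg-B₂))
      (bit o₁) (bit c₁) (bit p₁) (bit q₁) (bit o₂) (bit c₂) (bit p₂) (bit q₂) (bit o₃) k₁ k₂

  check : Bool
  check = admissible ∧ does (ends ≤? 2) ⇒ᵇ does (weight-bound ≤? 2 * (ends + 1))

local : Vec Bool 11 → ℕ → ℕ → Local
local (o₁ ∷ c₁ ∷ p₁ ∷ q₁ ∷ o₂ ∷ c₂ ∷ p₂ ∷ q₂ ∷ o₃ ∷ i₁ ∷ i₂ ∷ []) k₁ k₂ =
  record { o₁ = o₁ ; c₁ = c₁ ; p₁ = p₁ ; q₁ = q₁ ; o₂ = o₂ ; c₂ = c₂ ; p₂ = p₂ ; q₂ = q₂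
         ; o₃ = o₃ ; i₁ = i₁ ; i₂ = i₂ ; k₁ = k₁ ; k₂ = k₂ }

checks-for : Vec Bool 11 → ℕ → Bool
checks-for v k₁ = ∀≤2 λ k₂ → Local.check (local v k₁ k₂)

-- The local inequality, verified by evaluation on all 2 ^ 11 · 3 ^ 2 configurations.
all-checks : ∀ᵇ 11 (λ v → ∀≤2 (checks-for v)) ≡ true
all-checks = refl

local-bound : (L : Local) → let open Local L in
  k₁ ≤ 2 → k₂ ≤ 2 → admissible ≡ true → ends ≤ 2 → weight-bound ≤ 2 * (ends + 1)
local-bound L k₁≤2 k₂≤2 adm ends≤2 =
  does≡true⇒ (_ ≤? _) (⇒ᵇ-elim checked (cong₂ _∧_ adm (dec-true (_ ≤? 2) ends≤2)))
  where
  open Local L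
  v = o₁ ∷ c₁ ∷ p₁ ∷ q₁ ∷ o₂ ∷ c₂ ∷ p₂ ∷ q₂ ∷ o₃ ∷ i₁ ∷ i₂ ∷ []
  checked : check ≡ true
  checked = ∀≤2-sound (λ k₂ → Local.check (local v k₁ k₂))
    (∀≤2-sound (checks-for v) (∀ᵇ-sound 11 (λ v → ∀≤2 (checks-for v)) all-checks v) k₁ k₁≤2) k₂ k₂≤2

-- The weight of a path or cycle

A₁ B₁ A₂ B₂ : ℕ → ℕ → ℕ
A₁ j q = suc q
B₁ j q = last j (A₁ j q)
A₂ j q = suc (B₁ j q)
B₂ j q = last j (A₂ j q)

B₂-last : ∀ j q → suc (B₂ j q) ≡ last (suc j) q
B₂-last j q = lemma q (span j)
  where
  lemma : ∀ q s → suc (suc (suc (q + s)) + s) ≡ q + suc (suc (s + suc s))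
  lemma = solve-∀

Ascending : ℕ → ℕ → List ℕ → Set
Ascending lo hi []       = ⊤
Ascending lo hi (x ∷ xs) = lo ≤ x × x < hi × Ascending (suc x) hi xs

Ascending-weaken : ∀ {lo lo′ hi hi′} xs → lo ≤ lo′ → hi ≤ hi′ →
  Ascending lo′ hi xs → Ascending lo hi′ xs
Ascending-weaken []       _     _     _                = tt
Ascending-weaken (x ∷ xs) lo≤lo′ hi≤hi′ (lo′≤x , x<hi , rest) =
  ≤-trans lo≤lo′ lo′≤x , <-≤-trans x<hi hi≤hi′ , Ascending-weaken xs ≤-refl hi≤hi′ rest

Ascending-++ : ∀ {lo m hi} xs {ys} → lo ≤ m → m ≤ hi →
  Ascending lo m xs → Ascending m hi ys → Ascending lo hi (xs ++ ys)
Ascending-++ []       {ys} lo≤m m≤hi _ ys↑ = Ascending-weaken ys lo≤m ≤-refl ys↑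
Ascending-++ (x ∷ xs) lo≤m m≤hi (lo≤x , x<m , xs↑) ys↑ =
  lo≤x , <-≤-trans x<m m≤hi , Ascending-++ xs x<m m≤hi xs↑ ys↑

module Weights (d : ℕ) (H : Subgraph (Nested.G d)) (H-connected : ConnectedSub H)
               (H-deg≤2 : MaxDegreeSubAtMost H 2) where
  open Nested d

  E : ℕ → ℕ → Bool
  E a b = edge H (vertex a) (vertex b)

  E-sym : ∀ a b → E a b ≡ E b a
  E-sym a b = edge-sym H (vertex a) (vertex b)

  degH : ℕ → ℕ
  degH a = count (edge H (vertex a))

  degH≤2 : ∀ a → degH a ≤ 2
  degH≤2 a = subst (_≤ 2) (degreeIn≡count (edge H) (vertex a)) (H-deg≤2 (vertex a))

  isEnd : ℕ → Bool
  isEnd a = isOne (degH a)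

  entry exit : ℕ → ℕ → Bool
  entry j q = E q (suc q)
  exit  j q = E (pred (last j q)) (last j q)

  -- For the block of height j at q: ends j q counts the ends of H strictly inside it, weight j q
  -- weighs the chords of H inside it (2 ^ i at height i), inner j q says that H has an edge
  -- inside it other than the path edges entry j q and exit j q through its first and last
  -- vertex, and touched j q that H meets its interior.
  ends : ℕ → ℕ → ℕ
  ends zero    q = bit (isEnd (suc q))
  ends (suc j) q = bit (isEnd (A₁ j q)) + bit (isEnd (B₁ j q))
                 + (bit (isEnd (A₂ j q)) + bit (isEnd (B₂ j q)))
                 + ends j (A₁ j q) + ends j (A₂ j q)

  weight : ℕ → ℕ → ℕ
  weight zero    q = 0
  weight (suc j) q = 2 ^ j * (bit (E (A₁ j q) (B₁ j q)) + bit (E (A₂ j q) (B₂ j q)))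
                   + weight j (A₁ j q) + weight j (A₂ j q)

  inner touched : ℕ → ℕ → Bool
  inner zero    q = false
  inner (suc j) q = E (A₁ j q) (B₁ j q) ∨ E (A₂ j q) (B₂ j q) ∨ E (B₁ j q) (A₂ j q) ∨
                    touched j (A₁ j q) ∨ touched j (A₂ j q)
  touched j q = inner j q ∨ entry j q ∨ exit j q

  local-at : ℕ → ℕ → Local
  local-at j q = record
    { o₁ = E q (A₁ j q) ; c₁ = E (A₁ j q) (B₁ j q) ; p₁ = entry j (A₁ j q) ; q₁ = exit j (A₁ j q)
    ; o₂ = E (B₁ j q) (A₂ j q) ; c₂ = E (A₂ j q) (B₂ j q) ; p₂ = entry j (A₂ j q) ; q₂ = exit j (A₂ j q)
    ; o₃ = E (B₂ j q) (suc (B₂ j q)) ; i₁ = inner j (A₁ j q) ; i₂ = inner j (A₂ j q)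
    ; k₁ = ends j (A₁ j q) ; k₂ = ends j (A₂ j q)
    }

  <N : ∀ {a} → a ≤ span d → a < N
  <N = s≤s

  degH-positions : ∀ {a ws} → a < N → AllPairs _≢_ ws → All (_< N) ws →
    (∀ v → adjacent d a v ≡ true → v ∈ ws) → degH a ≡ sum (map (bit ∘ E a) ws)
  degH-positions {a} a<N distinct bounded support =
    count-positions (edge H (vertex a)) distinct bounded λ y a∼y →
      support (toℕ y) (subst (λ x → adjacent d x (toℕ y) ≡ true) (toℕ-vertex a<N) (edge-adj H (vertex a) y a∼y))

  degree-start : ∀ {j s} → Block d j (suc s) →
    degH (suc s) ≡ bit (E s (suc s)) + bit (E (suc s) (last j (suc s))) + bit (E (suc s) (suc (suc s)))
  degree-start {j} {s} B =
    trans (degH-positions (<N (≤-trans (<⇒≤ s+1<l) l≤span))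
            ((<⇒≢ s<s+2 ∷ <⇒≢ (<-trans s<s+2 s+2<l) ∷ []) ∷ (<⇒≢ s+2<l ∷ []) ∷ [] ∷ [])
            (<N (≤-trans (<⇒≤ (<-trans s<s+2 s+2<l)) l≤span) ∷ <N (≤-trans (<⇒≤ s+2<l) l≤span) ∷ <N l≤span ∷ [])
            support)
          (trans (rearrange (bit (E (suc s) s)) (bit (E (suc s) (suc (suc s)))) (bit (E (suc s) l)))
                 (cong (λ b → bit b + bit (E (suc s) l) + bit (E (suc s) (suc (suc s)))) (E-sym (suc s) s)))
    where
    l = last j (suc s)
    l≤span = last≤span B
    s+1<l : suc s < l
    s+1<l = p<last j (suc s)
    s+2<l : suc (suc s) < l
    s+2<l = p+2≤last j (suc s)
    s<s+2 : s < suc (suc s)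
    s<s+2 = <-trans (n<1+n s) (n<1+n (suc s))
    rearrange : ∀ x y z → x + (y + (z + 0)) ≡ x + z + y
    rearrange = solve-∀
    support : ∀ v → adjacent d (suc s) v ≡ true → v ∈ (s ∷ suc (suc s) ∷ l ∷ [])
    support v s∼v with neighbours-start B s∼v
    ... | inj₁ v+1≡s+1       = here (suc-injective v+1≡s+1)
    ... | inj₂ (inj₁ v≡s+2)  = there (here v≡s+2)
    ... | inj₂ (inj₂ v≡l)    = there (there (here v≡l))

  degree-last : ∀ {j s} → Block d j s → suc (last j s) ≤ span d →
    degH (last j s) ≡ bit (E s (last j s)) + bit (E (last j s) (suc (last j s))) + bit (E (pred (last j s)) (last j s))
  degree-last {j} {s} B l+1≤span =
    trans (degH-positions (<N l≤span)
            ((l-1≢l+1 ∷ (<⇒≢ s<l-1 ∘ sym) ∷ []) ∷ ((<⇒≢ s<l+1 ∘ sym) ∷ []) ∷ [] ∷ [])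
            (<N (≤-trans pred[n]≤n l≤span) ∷ <N l+1≤span ∷ <N (≤-trans (<⇒≤ (p<last j s)) l≤span) ∷ [])
            support)
          (trans (rearrange (bit (E l (pred l))) (bit (E l (suc l))) (bit (E l s)))
                 (cong₂ (λ b b′ → bit b + bit (E l (suc l)) + bit b′) (E-sym l s) (E-sym l (pred l))))
    where
    l = last j s
    l≤span = ≤-trans (n≤1+n l) l+1≤span
    s<l-1 : s < pred l
    s<l-1 = pred-mono-≤ (p+2≤last j s)
    s<l+1 : s < suc l
    s<l+1 = <-trans (p<last j s) (n<1+n l)
    l-1≢l+1 : pred l ≢ suc l
    l-1≢l+1 = <⇒≢ (s≤s pred[n]≤n)
    rearrange : ∀ x y z → x + (y + (z + 0)) ≡ z + y + x
    rearrange = solve-∀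
    support : ∀ v → adjacent d l v ≡ true → v ∈ (pred l ∷ suc l ∷ s ∷ [])
    support v l∼v with neighbours-last B l∼v
    ... | inj₁ v+1≡l        = here (cong pred v+1≡l)
    ... | inj₂ (inj₁ v≡l+1) = there (here v≡l+1)
    ... | inj₂ (inj₂ v≡s)   = there (there (here v≡s))

  degree-leaf-middle : ∀ {s} → Block d 0 s →
    degH (suc s) ≡ bit (E s (suc s)) + bit (E (pred (last 0 s)) (last 0 s))
  degree-leaf-middle {s} B =
    trans (degH-positions (<N (≤-trans (n≤1+n (suc s)) l≤span))
            ((<⇒≢ (p<last 0 s) ∷ []) ∷ [] ∷ [])
            (<N (≤-trans (<⇒≤ (p<last 0 s)) (last≤span B)) ∷ <N (last≤span B) ∷ [])
            (λ v m∼v → [ here , there ∘ here ]′ (neighbours-leaf-middle B m∼v)))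
          (cong₂ (λ b b′ → bit b + b′) (E-sym (suc s) s)
                 (trans (+-identityʳ _) (cong (λ x → bit (E (pred x) (last 0 s))) (sym l≡s+2))))
    where
    l≡s+2 : last 0 s ≡ suc (suc s)
    l≡s+2 = +-comm s 2
    l≤span : suc (suc s) ≤ span d
    l≤span = subst (_≤ span d) l≡s+2 (last≤span B)

  module _ (j q : ℕ) where

    q<A₁ : q < A₁ j q
    q<A₁ = n<1+n q

    A₁<B₁ : A₁ j q < B₁ j q
    A₁<B₁ = p<last j (A₁ j q)

    B₁<A₂ : B₁ j q < A₂ j q
    B₁<A₂ = n<1+n (B₁ j q)

    A₂<B₂ : A₂ j q < B₂ j q
    A₂<B₂ = p<last j (A₂ j q)

    B₂<last : B₂ j q < last (suc j) q
    B₂<last = subst (B₂ j q <_) (B₂-last j q) (n<1+n (B₂ j q))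

  Within : ℕ → ℕ → ℕ → Set
  Within q l a = q < a × a < l

  Inner-edge : ℕ → ℕ → Set
  Inner-edge j q = Σ ℕ λ a → Σ ℕ λ b → E a b ≡ true × Within q (last j q) a

  inner-sound : ∀ j q → inner j q ≡ true → Inner-edge j q
  inner-sound (suc j) q h =
    ∨-cases h (at (A₁ j q) (B₁ j q) (q<A₁ j q) A₁<last) λ h →
    ∨-cases h (at (A₂ j q) (B₂ j q) q<A₂ A₂<last) λ h →
    ∨-cases h (at (B₁ j q) (A₂ j q) (<-trans (q<A₁ j q) (A₁<B₁ j q)) B₁<last) λ h →
    ∨-cases h (child (A₁ j q) (q<A₁ j q) (<⇒≤ B₁<last)) (child (A₂ j q) q<A₂ (<⇒≤ (B₂<last j q)))
    where
    A₂<last : A₂ j q < last (suc j) q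
    A₂<last = <-trans (A₂<B₂ j q) (B₂<last j q)
    B₁<last : B₁ j q < last (suc j) q
    B₁<last = <-trans (B₁<A₂ j q) A₂<last
    A₁<last : A₁ j q < last (suc j) q
    A₁<last = <-trans (A₁<B₁ j q) B₁<last
    q<A₂ : q < A₂ j q
    q<A₂ = <-trans (q<A₁ j q) (<-trans (A₁<B₁ j q) (B₁<A₂ j q))
    at : ∀ a b → q < a → a < last (suc j) q → E a b ≡ true → Inner-edge (suc j) q
    at a b q<a a<l ab = a , b , ab , q<a , a<l
    child : ∀ s → q < s → last j s ≤ last (suc j) q → touched j s ≡ true → Inner-edge (suc j) q
    child s q<s l≤ h =
      ∨-cases h (λ h → let a , b , ab , s<a , a<l = inner-sound j s h in
                         at a b (<-trans q<s s<a) (<-≤-trans a<l l≤) ab) λ h →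
      ∨-cases h (at s (suc s) q<s (<-≤-trans (p<last j s) l≤))
                (at (pred (last j s)) (last j s) (<-trans q<s (pred-mono-≤ (p+2≤last j s)))
                                                (<-≤-trans (last-1<last j s) l≤))

  module _ {j q} (B : Block d (suc j) q) where
    open Local (local-at j q) using (deg-A₁; deg-B₁; deg-A₂; deg-B₂)

    degree-A₁ : degH (A₁ j q) ≡ deg-A₁
    degree-A₁ = degree-start (child₁ B)

    degree-B₁ : degH (B₁ j q) ≡ deg-B₁
    degree-B₁ = degree-last (child₁ B) (≤-trans (<⇒≤ (<-trans (A₂<B₂ j q) (B₂<last j q))) (last≤span B))

    degree-A₂ : degH (A₂ j q) ≡ deg-A₂
    degree-A₂ = degree-start (child₂ B)

    degree-B₂ : degH (B₂ j q) ≡ deg-B₂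
    degree-B₂ = degree-last (child₂ B) (subst (_≤ span d) (sym (B₂-last j q)) (last≤span B))

    ends-suc : ends (suc j) q ≡ Local.ends (local-at j q)
    ends-suc = cong (λ n → n + ends j (A₁ j q) + ends j (A₂ j q))
      (cong₂ _+_ (cong₂ (λ a b → bit (isOne a) + bit (isOne b)) degree-A₁ degree-B₁)
                 (cong₂ (λ a b → bit (isOne a) + bit (isOne b)) degree-A₂ degree-B₂))

  exit-suc : ∀ j q → E (B₂ j q) (suc (B₂ j q)) ≡ exit (suc j) q
  exit-suc j q = cong (λ y → E (pred y) y) (B₂-last j q)

  degree-bounded : ∀ a {n} → degH a ≡ n → n ≤ 2
  degree-bounded a deg≡n = subst (_≤ 2) deg≡n (degH≤2 a)

  parity : ∀ {j q} → Block d j q → 2 ∣ ends j q + bit (entry j q) + bit (exit j q)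
  parity {zero} {q} B =
    subst (2 ∣_) (trans (cong (bit (isEnd (suc q)) +_) (degree-leaf-middle B))
                        (sym (+-assoc (bit (isEnd (suc q))) (bit (entry 0 q)) (bit (exit 0 q)))))
      (2∣isOne+ (degH≤2 (suc q)))
  parity {suc j} {q} B =
    subst₂ (λ n o → 2 ∣ n + bit (entry (suc j) q) + bit o) (sym (ends-suc B)) (exit-suc j q)
      (Local.parity (local-at j q)
        (degree-bounded (A₁ j q) (degree-A₁ B)) (degree-bounded (B₁ j q) (degree-B₁ B))
        (degree-bounded (A₂ j q) (degree-A₂ B)) (degree-bounded (B₂ j q) (degree-B₂ B))
        (parity (child₁ B)) (parity (child₂ B)))

  no-end : ∀ a → degH a ≡ 0 → bit (isEnd a) ≡ 0
  no-end a deg≡0 = cong (bit ∘ isOne) deg≡0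

  bits₃ : ∀ {x y z} → x ≡ false → y ≡ false → z ≡ false → bit x + bit y + bit z ≡ 0
  bits₃ refl refl refl = refl

  untouched : ∀ {j q} → Block d j q → touched j q ≡ false → ends j q ≡ 0 × weight j q ≡ 0
  untouched {zero} {q} B none with entry≡f , exit≡f ← ∨≡false⇒ {entry 0 q} none =
    no-end (suc q) (trans (degree-leaf-middle B) (cong₂ (λ x y → bit x + bit y) entry≡f exit≡f)) , refl
  untouched {suc j} {q} B none
    with inner≡f , boundary≡f ← ∨≡false⇒ {inner (suc j) q} none
    with o₁≡f , o₃≡f ← ∨≡false⇒ {entry (suc j) q} boundary≡f
    with c₁≡f , rest ← ∨≡false⇒ {E (A₁ j q) (B₁ j q)} inner≡f
    with c₂≡f , rest ← ∨≡false⇒ {E (A₂ j q) (B₂ j q)} rest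
    with o₂≡f , rest ← ∨≡false⇒ {E (B₁ j q) (A₂ j q)} rest
    with t₁≡f , t₂≡f ← ∨≡false⇒ {touched j (A₁ j q)} rest
    with _ , p₁q₁≡f ← ∨≡false⇒ {inner j (A₁ j q)} t₁≡f
    with _ , p₂q₂≡f ← ∨≡false⇒ {inner j (A₂ j q)} t₂≡f
    with p₁≡f , q₁≡f ← ∨≡false⇒ {entry j (A₁ j q)} p₁q₁≡f
    with p₂≡f , q₂≡f ← ∨≡false⇒ {entry j (A₂ j q)} p₂q₂≡f
    with k₁≡0 , w₁≡0 ← untouched (child₁ B) t₁≡f
    with k₂≡0 , w₂≡0 ← untouched (child₂ B) t₂≡f =
    cong₂ _+_ (cong₂ _+_ (cong₂ _+_
      (cong₂ _+_ (no-end (A₁ j q) (trans (degree-A₁ B) (bits₃ o₁≡f c₁≡f p₁≡f)))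
                 (no-end (B₁ j q) (trans (degree-B₁ B) (bits₃ c₁≡f o₂≡f q₁≡f))))
      (cong₂ _+_ (no-end (A₂ j q) (trans (degree-A₂ B) (bits₃ o₂≡f c₂≡f p₂≡f)))
                 (no-end (B₂ j q) (trans (degree-B₂ B) (bits₃ c₂≡f o₃≡f′ q₂≡f)))))
      k₁≡0) k₂≡0 ,
    cong₂ _+_ (cong₂ _+_ (trans (cong₂ (λ x y → 2 ^ j * (bit x + bit y)) c₁≡f c₂≡f) (*-zeroʳ (2 ^ j))) w₁≡0) w₂≡0
    where o₃≡f′ = trans (exit-suc j q) o₃≡f

  H-step : Fin N → Fin N → Set
  H-step x y = edge H x y ≡ true

  edge-E : ∀ {x y a b} → toℕ x ≡ a → toℕ y ≡ b → edge H x y ≡ E a b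
  edge-E {x} {y} refl refl = cong₂ (edge H) (sym (vertex-toℕ x)) (sym (vertex-toℕ y))

  trapped : (P : ℕ → Set) → (∀ {x y} → H-step x y → P (toℕ x) → P (toℕ y)) →
    ∀ {u w} → u < N → w < N → vert H (vertex u) ≡ true → vert H (vertex w) ≡ true → P u → P w
  trapped P step {u} {w} u<N w<N u∈H w∈H Pu =
    subst P (toℕ-vertex w<N)
      (Star-invariant (P ∘ toℕ) step (proj₂ H-connected _ _ u∈H w∈H) (subst P (sym (toℕ-vertex u<N)) Pu))

  interior-separates : ∀ {j s} → Block d j s → entry j s ≡ false → exit j s ≡ false →
    ∀ {u w} → w < N → vert H (vertex u) ≡ true → vert H (vertex w) ≡ true →
    Within s (last j s) u → Within s (last j s) w
  interior-separates {j} {s} B no-entry no-exit w<N u∈H w∈H u-in =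
    trapped (Within s (last j s)) step (<N (≤-trans (<⇒≤ (proj₂ u-in)) (last≤span B))) w<N u∈H w∈H u-in
    where
    step : ∀ {x y} → H-step x y → Within s (last j s) (toℕ x) → Within s (last j s) (toℕ y)
    step {x} {y} xy (s<x , x<l) with (s <? toℕ y) ×-dec (toℕ y <? last j s)
    ... | yes y-in = y-in
    ... | no y-out with leaving-interior B (edge-adj H x y xy) s<x x<l y-out
    ...   | inj₁ (x≡s+1 , y≡s) =
            contradiction (trans (sym xy) (trans (edge-E x≡s+1 y≡s) (trans (E-sym (suc s) s) no-entry))) λ ()
    ...   | inj₂ (x+1≡l , y≡l) =
            contradiction (trans (sym xy) (trans (edge-E (cong pred x+1≡l) y≡l) no-exit)) λ ()

  Between : ℕ → ℕ → ℕ → Set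
  Between s l a = s ≤ a × a ≤ l

  block-separates : ∀ {j s} → Block d j s → E (pred s) s ≡ false → E (last j s) (suc (last j s)) ≡ false →
    ∀ {u w} → w < N → vert H (vertex u) ≡ true → vert H (vertex w) ≡ true →
    Between s (last j s) u → Between s (last j s) w
  block-separates {j} {s} B no-before no-after w<N u∈H w∈H u-in =
    trapped (Between s (last j s)) step (<N (≤-trans (proj₂ u-in) (last≤span B))) w<N u∈H w∈H u-in
    where
    step : ∀ {x y} → H-step x y → Between s (last j s) (toℕ x) → Between s (last j s) (toℕ y)
    step {x} {y} xy (s≤x , x≤l) with (s ≤? toℕ y) ×-dec (toℕ y ≤? last j s)
    ... | yes y-in = y-in
    ... | no y-out with leaving-block B (edge-adj H x y xy) s≤x x≤l y-out
    ...   | inj₁ (y+1≡s , x≡s) =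
            contradiction (trans (sym xy) (trans (edge-E x≡s (cong pred y+1≡s))
                                                 (trans (E-sym s (pred s)) no-before))) λ ()
    ...   | inj₂ (x≡l , y≡l+1) =
            contradiction (trans (sym xy) (trans (edge-E x≡l y≡l+1) no-after)) λ ()

  vert-left : ∀ a b → E a b ≡ true → vert H (vertex a) ≡ true
  vert-left a b = edge-vert H (vertex a) (vertex b)

  vert-right : ∀ a b → E a b ≡ true → vert H (vertex b) ≡ true
  vert-right a b ab = vert-left b a (trans (E-sym b a) ab)

  touched-vertex : ∀ j s → touched j s ≡ true → Σ ℕ λ u → vert H (vertex u) ≡ true × Between s (last j s) u
  touched-vertex j s h =
    ∨-cases h (λ h → let a , b , ab , s<a , a<l = inner-sound j s h in
                      a , vert-left a b ab , <⇒≤ s<a , <⇒≤ a<l) λ h →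
    ∨-cases h (λ h → s , vert-left s (suc s) h , ≤-refl , <⇒≤ (p<last j s))
              (λ h → last j s , vert-right (pred (last j s)) (last j s) h , <⇒≤ (p<last j s) , ≤-refl)

  module _ {j q} (B : Block d (suc j) q) where
    open Local (local-at j q) using (o₁; c₁; p₁; q₁; o₂; c₂; p₂; q₂; o₃; i₁; i₂; touched₁; touched₂)

    private
      A₂<N : A₂ j q < N
      A₂<N = <N (≤-trans (<⇒≤ (<-trans (A₂<B₂ j q) (B₂<last j q))) (last≤span B))
      B₁<N : B₁ j q < N
      B₁<N = <-trans (B₁<A₂ j q) A₂<N
      A₁<N : A₁ j q < N
      A₁<N = <-trans (A₁<B₁ j q) B₁<N

    first-child-exits : i₁ ∧ o₂ ≡ true → p₁ ∨ q₁ ≡ false → ⊥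
    first-child-exits h none with i₁≡t , o₂≡t ← ∧≡true⇒ h with p₁≡f , q₁≡f ← ∨≡false⇒ {p₁} none =
      let a , b , ab , a-in = inner-sound j (A₁ j q) i₁≡t in
      <-irrefl refl (proj₂ (interior-separates (child₁ B) p₁≡f q₁≡f B₁<N
                              (vert-left a b ab) (vert-left (B₁ j q) (A₂ j q) o₂≡t) a-in))

    second-child-exits : i₂ ∧ o₂ ≡ true → p₂ ∨ q₂ ≡ false → ⊥
    second-child-exits h none with i₂≡t , o₂≡t ← ∧≡true⇒ h with p₂≡f , q₂≡f ← ∨≡false⇒ {p₂} none =
      let a , b , ab , a-in = inner-sound j (A₂ j q) i₂≡t in
      <-asym (B₁<A₂ j q) (proj₁ (interior-separates (child₂ B) p₂≡f q₂≡f B₁<N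
                                   (vert-left a b ab) (vert-left (B₁ j q) (A₂ j q) o₂≡t) a-in))

    first-child-joins : (touched₁ ∨ c₁) ∧ c₂ ≡ true → o₁ ∨ o₂ ≡ false → ⊥
    first-child-joins h none with t≡t , c₂≡t ← ∧≡true⇒ h with o₁≡f , o₂≡f ← ∨≡false⇒ {o₁} none =
      let u , u∈H , u-in = ∨-cases t≡t (touched-vertex j (A₁ j q))
                             (λ c₁≡t → A₁ j q , vert-left (A₁ j q) (B₁ j q) c₁≡t , ≤-refl , <⇒≤ (A₁<B₁ j q)) in
      <⇒≱ (B₁<A₂ j q) (proj₂ (block-separates (child₁ B) o₁≡f o₂≡f A₂<N
                                 u∈H (vert-left (A₂ j q) (B₂ j q) c₂≡t) u-in))

    second-child-joins : (touched₂ ∨ c₂) ∧ c₁ ≡ true → o₃ ∨ o₂ ≡ false → ⊥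
    second-child-joins h none with t≡t , c₁≡t ← ∧≡true⇒ h with o₃≡f , o₂≡f ← ∨≡false⇒ {o₃} none =
      let u , u∈H , u-in = ∨-cases t≡t (touched-vertex j (A₂ j q))
                             (λ c₂≡t → A₂ j q , vert-left (A₂ j q) (B₂ j q) c₂≡t , ≤-refl , <⇒≤ (A₂<B₂ j q)) in
      <⇒≱ (<-trans (A₁<B₁ j q) (B₁<A₂ j q)) (proj₁ (block-separates (child₂ B) o₂≡f o₃≡f A₁<N
                                                   u∈H (vert-left (A₁ j q) (B₁ j q) c₁≡t) u-in))

  untouched-no-ends : ∀ {j s} → Block d j s → not (touched j s) ≡ true → does (ends j s ≟ 0) ≡ false → ⊥
  untouched-no-ends {j} {s} C h k≢0 with touched j s in t
  untouched-no-ends C () k≢0 | true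
  ... | false = contradiction (trans (sym (dec-true (_ ≟ 0) (proj₁ (untouched C t)))) k≢0) λ ()

  local-admissible : ∀ {j q} → Block d (suc j) q → Local.admissible (local-at j q) ≡ true
  local-admissible {j} {q} B =
    degree-ok (A₁ j q) (degree-A₁ B) ∧′ degree-ok (B₁ j q) (degree-B₁ B) ∧′
    degree-ok (A₂ j q) (degree-A₂ B) ∧′ degree-ok (B₂ j q) (degree-B₂ B) ∧′
    ⇒ᵇ-intro (first-child-exits B) ∧′ ⇒ᵇ-intro (second-child-exits B) ∧′
    ⇒ᵇ-intro (first-child-joins B) ∧′ ⇒ᵇ-intro (second-child-joins B) ∧′
    dec-true (2 ∣? _) (parity (child₁ B)) ∧′ dec-true (2 ∣? _) (parity (child₂ B)) ∧′
    ⇒ᵇ-intro (untouched-no-ends (child₁ B)) ∧′ ⇒ᵇ-intro (untouched-no-ends (child₂ B))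
    where
    infixr 6 _∧′_
    _∧′_ : ∀ {a b} → a ≡ true → b ≡ true → a ∧ b ≡ true
    _∧′_ = cong₂ _∧_
    degree-ok : ∀ a {n} → degH a ≡ n → does (n ≤? 2) ≡ true
    degree-ok a deg≡n = dec-true (_ ≤? 2) (degree-bounded a deg≡n)

  bound : ∀ {j q} → Block d j q → ends j q ≤ 2 → weight j q ≤ (ends j q + 1) * 2 ^ j
  weight≤ : ∀ {j q} → Block d j q → ends j q ≤ 2 → weight j q ≤ bit (touched j q) * (ends j q + 1) * 2 ^ j

  weight≤ {j} {q} B ends≤2 with touched j q in t
  ... | true  = subst (weight j q ≤_) (cong (_* 2 ^ j) (sym (*-identityˡ (ends j q + 1)))) (bound B ends≤2)
  ... | false = ≤-reflexive (proj₂ (untouched B t))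

  bound {zero}      B _      = z≤n
  bound {suc j} {q} B ends≤2 = begin
    weight (suc j) q
      ≤⟨ +-mono-≤ (+-monoʳ-≤ (2 ^ j * (bit c₁ + bit c₂)) (weight≤ (child₁ B) k₁≤2)) (weight≤ (child₂ B) k₂≤2) ⟩
    2 ^ j * (bit c₁ + bit c₂) + bit touched₁ * (k₁ + 1) * 2 ^ j + bit touched₂ * (k₂ + 1) * 2 ^ j
      ≡⟨ collect (2 ^ j) (bit c₁) (bit c₂) (bit touched₁ * (k₁ + 1)) (bit touched₂ * (k₂ + 1)) ⟩
    weight-bound * 2 ^ j
      ≤⟨ *-monoˡ-≤ (2 ^ j) (local-bound (local-at j q) k₁≤2 k₂≤2 (local-admissible B) ends≤2′) ⟩
    2 * (Local.ends (local-at j q) + 1) * 2 ^ j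
      ≡⟨ cong (λ n → 2 * (n + 1) * 2 ^ j) (sym (ends-suc B)) ⟩
    2 * (ends (suc j) q + 1) * 2 ^ j
      ≡⟨ double (ends (suc j) q + 1) (2 ^ j) ⟩
    (ends (suc j) q + 1) * 2 ^ suc j ∎
    where
    open ≤-Reasoning
    open Local (local-at j q) using (c₁; c₂; k₁; k₂; touched₁; touched₂; weight-bound; new-ends)
    ends≤2′ : Local.ends (local-at j q) ≤ 2
    ends≤2′ = subst (_≤ 2) (ends-suc B) ends≤2
    k₁≤2 : k₁ ≤ 2
    k₁≤2 = ≤-trans (≤-trans (m≤n+m k₁ new-ends) (m≤m+n (new-ends + k₁) k₂)) ends≤2′
    k₂≤2 : k₂ ≤ 2
    k₂≤2 = ≤-trans (m≤n+m k₂ (new-ends + k₁)) ends≤2′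
    collect : ∀ P x y t₁ t₂ → P * (x + y) + t₁ * P + t₂ * P ≡ (x + y + t₁ + t₂) * P
    collect = solve-∀
    double : ∀ n P → 2 * n * P ≡ n * (2 * P)
    double = solve-∀

  endAt : ℕ → List ℕ
  endAt v = if isEnd v then v ∷ [] else []

  endList : ℕ → ℕ → List ℕ
  endList zero    q = endAt (suc q)
  endList (suc j) q = endAt (A₁ j q) ++ endList j (A₁ j q) ++ endAt (B₁ j q) ++
                      endAt (A₂ j q) ++ endList j (A₂ j q) ++ endAt (B₂ j q)

  length-endAt : ∀ v → length (endAt v) ≡ bit (isEnd v)
  length-endAt v with isEnd v
  ... | true  = refl
  ... | false = refl

  length-endList : ∀ j q → length (endList j q) ≡ ends j q
  length-endList zero    q = length-endAt (suc q)
  length-endList (suc j) q =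
    trans (⊕ (endAt a₁) (length-endAt a₁) (⊕ (endList j a₁) (length-endList j a₁)
            (⊕ (endAt b₁) (length-endAt b₁) (⊕ (endAt a₂) (length-endAt a₂)
              (⊕ (endList j a₂) (length-endList j a₂) (length-endAt b₂))))))
          (arrange (bit (isEnd a₁)) (bit (isEnd b₁)) (bit (isEnd a₂)) (bit (isEnd b₂))
                   (ends j a₁) (ends j a₂))
    where
    a₁ = A₁ j q
    b₁ = B₁ j q
    a₂ = A₂ j q
    b₂ = B₂ j q
    ⊕ : ∀ xs {ys : List ℕ} {m n} → length xs ≡ m → length ys ≡ n → length (xs ++ ys) ≡ m + n
    ⊕ xs refl refl = length-++ xs
    arrange : ∀ a b c e k l → a + (k + (b + (c + (l + e)))) ≡ a + b + (c + e) + k + l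
    arrange = solve-∀

  endAt-ascending : ∀ v → Ascending v (suc v) (endAt v)
  endAt-ascending v with isEnd v
  ... | true  = ≤-refl , ≤-refl , tt
  ... | false = tt

  endAt-ends : ∀ v → All (λ x → isEnd x ≡ true) (endAt v)
  endAt-ends v with isEnd v in end?
  ... | true  = end? ∷ []
  ... | false = []

  endList-ascending : ∀ j q → Ascending (suc q) (last j q) (endList j q)
  endList-ascending zero q =
    Ascending-weaken (endAt (suc q)) ≤-refl (≤-reflexive (+-comm 2 q)) (endAt-ascending (suc q))
  endList-ascending (suc j) q = subst (λ l → Ascending (suc q) l (endList (suc j) q)) (B₂-last j q)
    (Ascending-++ (endAt a₁) (n≤1+n a₁) (≤-trans a₁<b₁ b₁≤Y) (endAt-ascending a₁)
    (Ascending-++ (endList j a₁) a₁<b₁ b₁≤Y (endList-ascending j a₁)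
    (Ascending-++ (endAt b₁) (n≤1+n b₁) a₂≤Y (endAt-ascending b₁)
    (Ascending-++ (endAt a₂) (n≤1+n a₂) (≤-trans a₂<b₂ (n≤1+n b₂)) (endAt-ascending a₂)
    (Ascending-++ (endList j a₂) a₂<b₂ (n≤1+n b₂) (endList-ascending j a₂)
      (endAt-ascending b₂))))))
    where
    a₁ = A₁ j q
    b₁ = B₁ j q
    a₂ = A₂ j q
    b₂ = B₂ j q
    a₁<b₁ : suc a₁ ≤ b₁
    a₁<b₁ = A₁<B₁ j q
    a₂<b₂ : suc a₂ ≤ b₂
    a₂<b₂ = A₂<B₂ j q
    a₂≤Y : a₂ ≤ suc b₂
    a₂≤Y = ≤-trans (<⇒≤ a₂<b₂) (n≤1+n b₂)
    b₁≤Y : b₁ ≤ suc b₂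
    b₁≤Y = ≤-trans (n≤1+n b₁) a₂≤Y

  endList-ends : ∀ j q → All (λ x → isEnd x ≡ true) (endList j q)
  endList-ends zero q = endAt-ends (suc q)
  endList-ends (suc j) q =
    ++⁺ (endAt-ends (A₁ j q)) (++⁺ (endList-ends j (A₁ j q)) (++⁺ (endAt-ends (B₁ j q))
      (++⁺ (endAt-ends (A₂ j q)) (++⁺ (endList-ends j (A₂ j q)) (endAt-ends (B₂ j q))))))

  H-path-or-cycle : PathOrCycle (edge H)
  H-path-or-cycle = record
    { symmetric   = edge-sym H
    ; irreflexive = irreflexive
    ; deg≤2       = λ v → subst (_≤ 2) (degreeIn≡count (edge H) v) (H-deg≤2 v)
    ; linked      = λ u v 1≤u 1≤v → proj₂ H-connected u v (in-H u 1≤u) (in-H v 1≤v)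
    }
    where
    irreflexive : ∀ a → edge H a a ≡ false
    irreflexive a with edge H a a in loop
    ... | false = refl
    ... | true  = contradiction (trans (sym (edge-adj H a a loop)) (adj-irrefl G a)) λ ()
    in-H : ∀ u → 1 ≤ deg (edge H) u → vert H u ≡ true
    in-H u 1≤deg = let w , uw = count-witness (edge H u) 1≤deg in edge-vert H u w uw

  at-most-two-ends : ∀ {lo} xs → Ascending lo N xs → All (λ x → isEnd x ≡ true) xs → length xs ≤ 2
  at-most-two-ends []              _ _ = z≤n
  at-most-two-ends (_ ∷ [])        _ _ = s≤s z≤n
  at-most-two-ends (_ ∷ _ ∷ [])    _ _ = s≤s (s≤s z≤n)
  at-most-two-ends (x ∷ y ∷ z ∷ _) (_ , x<N , x<y , y<N , y<z , z<N , _) (x-end ∷ y-end ∷ z-end ∷ _) =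
    ⊥-elim (no-three-ends H-path-or-cycle
      (vertex-injective x<N y<N (<⇒≢ x<y)) (vertex-injective x<N z<N (<⇒≢ (<-trans x<y y<z)))
      (vertex-injective y<N z<N (<⇒≢ y<z))
      (end-degree x x-end) (end-degree y y-end) (end-degree z z-end))
    where
    end-degree : ∀ a → isEnd a ≡ true → deg (edge H) (vertex a) ≡ 1
    end-degree a = does≡true⇒ (degH a ≟ 1)

  root-ends≤2 : ends d 0 ≤ 2
  root-ends≤2 = subst (_≤ 2) (length-endList d 0)
    (at-most-two-ends (endList d 0)
      (Ascending-weaken (endList d 0) z≤n (n≤1+n (span d)) (endList-ascending d 0))
      (endList-ends d 0))

  root-weight : weight d 0 ≤ 3 * 2 ^ d
  root-weight = ≤-trans (bound root root-ends≤2) (*-monoˡ-≤ (2 ^ d) (+-monoˡ-≤ 1 root-ends≤2))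

-- Coverings

module Cover (d m : ℕ) (F : Fin m → Subgraph (Nested.G d)) (F-connected : ∀ i → ConnectedSub (F i))
             (F-deg≤2 : ∀ i → MaxDegreeSubAtMost (F i) 2) (covers : Covers (Nested.G d) F) where
  open Nested d using (vertex; chord-edge)

  weightOf : Fin m → ℕ → ℕ → ℕ
  weightOf i = Weights.weight d (F i) (F-connected i) (F-deg≤2 i)

  chord-covered : ∀ {j a} → Block d j a → 1 ≤ ∑ (λ i → bit (edge (F i) (vertex a) (vertex (last j a))))
  chord-covered {j} {a} B with covers _ _ (chord-edge (j , B , refl))
  ... | i , covered = subst (λ b → bit b ≤ ∑ chosen) covered (≤-∑ chosen i)
    where
    chosen : Fin m → ℕ
    chosen i = bit (edge (F i) (vertex a) (vertex (last j a)))

  -- Every chord is covered, and the chords of each level of sub-blocks weigh 2 ^ j in total.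
  total-weight : ∀ {j q} → Block d j q → j * 2 ^ j ≤ ∑ (λ i → weightOf i j q)
  total-weight {zero}      B = z≤n
  total-weight {suc j} {q} B = begin
    suc j * 2 ^ suc j
      ≡⟨ levels (2 ^ j) j ⟩
    2 ^ j * (1 + 1) + j * 2 ^ j + j * 2 ^ j
      ≤⟨ +-mono-≤ (+-mono-≤ (*-monoʳ-≤ (2 ^ j) (+-mono-≤ (chord-covered (child₁ B)) (chord-covered (child₂ B))))
                            (total-weight (child₁ B)))
                  (total-weight (child₂ B)) ⟩
    2 ^ j * (∑ c₁ + ∑ c₂) + ∑ w₁ + ∑ w₂
      ≡⟨ cong (λ n → n + ∑ w₁ + ∑ w₂) (cong (2 ^ j *_) (sym (∑-+ c₁ c₂))) ⟩
    2 ^ j * ∑ (λ i → c₁ i + c₂ i) + ∑ w₁ + ∑ w₂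
      ≡⟨ cong (λ n → n + ∑ w₁ + ∑ w₂) (sym (∑-*ˡ (2 ^ j) (λ i → c₁ i + c₂ i))) ⟩
    ∑ (λ i → 2 ^ j * (c₁ i + c₂ i)) + ∑ w₁ + ∑ w₂
      ≡⟨ cong (_+ ∑ w₂) (sym (∑-+ (λ i → 2 ^ j * (c₁ i + c₂ i)) w₁)) ⟩
    ∑ (λ i → 2 ^ j * (c₁ i + c₂ i) + w₁ i) + ∑ w₂
      ≡⟨ sym (∑-+ (λ i → 2 ^ j * (c₁ i + c₂ i) + w₁ i) w₂) ⟩
    ∑ (λ i → weightOf i (suc j) q) ∎
    where
    open ≤-Reasoning
    c₁ c₂ w₁ w₂ : Fin m → ℕ
    c₁ i = bit (edge (F i) (vertex (A₁ j q)) (vertex (B₁ j q)))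
    c₂ i = bit (edge (F i) (vertex (A₂ j q)) (vertex (B₂ j q)))
    w₁ i = weightOf i j (A₁ j q)
    w₂ i = weightOf i j (A₂ j q)
    levels : ∀ P j → suc j * (2 * P) ≡ P * (1 + 1) + j * P + j * P
    levels = solve-∀

  cover-size : d ≤ 3 * m
  cover-size = *-cancelʳ-≤ d (3 * m) (2 ^ d) {{m^n≢0 2 d}} (begin
    d * 2 ^ d                  ≤⟨ total-weight root ⟩
    ∑ (λ i → weightOf i d 0)   ≤⟨ ∑-mono (λ i → Weights.root-weight d (F i) (F-connected i) (F-deg≤2 i)) ⟩
    ∑ {m} (λ _ → 3 * 2 ^ d)    ≡⟨ ∑-const {m} (3 * 2 ^ d) ⟩
    m * (3 * 2 ^ d)            ≡⟨ rearrange m (2 ^ d) ⟩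
    3 * m * 2 ^ d              ∎)
    where
    open ≤-Reasoning
    rearrange : ∀ m P → m * (3 * P) ≡ 3 * m * P
    rearrange = solve-∀

mainTheorem20 : ∀ (k : ℕ) → 2 ≤ k →
    ∃[ G ] (TwoConnected G × Outerplanar G × MaxDegree G 3 ×
      (∀ (m : ℕ) (F : Fin m → Subgraph G) →
        (∀ i → ConnectedSub (F i)) →
        (∀ i → MaxDegreeSubAtMost (F i) 2) →
        Covers G F → k ≤ m))
mainTheorem20 k (s≤s (s≤s _)) =
  G , twoConnected , outerplanar , maxDegree {d} (s≤s z≤n) ,
  λ m F F-connected F-deg≤2 covers → *-cancelˡ-≤ 3 (Cover.cover-size d m F F-connected F-deg≤2 covers)
  where
  d = 3 * k
  open Nested d
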